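{- Let $T$ be a moon polyomino with $s$ rows and $t$ columns. For every $s$-tuple $\mathbf{m}$ and $t$-tuple $\mathbf{n}$ of nonnegative integers and all $A\subseteq[t]$, $B\subseteq[s]$, the joint statistic $(\mathrm{ne}_2,\mathrm{se}_2)$ is symmetrically distributed over each of $\mathcal{N}^c(T,\mathbf{m};A)$, $\mathcal{N}^r(T,\mathbf{n};B)$ and $\mathcal{N}(T;A,B)$; that is, for each such set $\mathcal{S}$, $\sum_{F\in\mathcal{S}}p^{\mathrm{ne}_2(F)}q^{\mathrm{se}_2(F)}=\sum_{F\in\mathcal{S}}p^{\mathrm{se}_2(F)}q^{\mathrm{ne}_2(F)}$. In particular it is symmetrically distributed over each $\mathcal{N}^c(T,\mathbf{m})$ and each $\mathcal{N}^r(T,\mathbf{n})$.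
   Context: A moon polyomino is a finite set of unit cells of the integer grid that is convex (every row and every column of cells is a contiguous segment) and intersection-free (for any two rows, the set of horizontal positions of one contains that of the other; equivalently for columns). Rows $R_1,\dots,R_s$ are labelled top to bottom and columns $C_1,\dots,C_t$ left to right. A $01$-filling assigns $0$ or $1$ to each cell. An ascent (resp. descent) of $F$ is a pair of $1$-cells, the second strictly above (resp. strictly below) and strictly to the right of the first, such that the smallest rectangle containing both cells is contained in $T$; $\mathrm{ne}_2(F)$ and $\mathrm{se}_2(F)$ count ascents and descents. A row or column is empty if all its entries are $0$. $\mathcal{N}^c(T,\mathbf{m})$: fillings with at most one $1$ per column and exactly $m_i$ ones in $R_i$ for each $i$; $\mathcal{N}^c(T,\mathbf{m};A)$: those whose set of indices of empty columns equals $A$. $\mathcal{N}^r(T,\mathbf{n})$: fillings with at most one $1$ per row and exactly $n_j$ ones in $C_j$ for each $j$; $\mathcal{N}^r(T,\mathbf{n};B)$: those whose set of indices of empty rows equals $B$. $\mathcal{N}(T;A,B)$: fillings with at most one $1$ in each row and each column whose empty-column index set is $A$ and empty-row index set is $B$. -}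

module Defs where

open import Data.Bool using (Bool; true; false; _∧_; _∨_; not; if_then_else_)
open import Data.Nat using (ℕ; zero; suc; _≤_; _≡ᵇ_; _<ᵇ_; _≤ᵇ_)
open import Data.Fin using (Fin; toℕ)
open import Data.Fin.Subset using (Subset)
open import Data.Vec using (Vec; []; _∷_; lookup)
open import Data.List using (List; []; _∷_; map; concatMap; allFin)
open import Data.Bool.ListAction using (all)
open import Data.Nat.ListAction using (sum)
open import Data.Product using (_×_; _,_; ∃-syntax)
open import Data.Sum using (_⊎_)
open import Relation.Binary.PropositionalEquality using (_≡_)

-- Rows are indexed by Fin s (index 0 = top row R₁, increasing
-- downwards), columns by Fin t (index 0 = leftmost column C₁).

Shape : ℕ → ℕ → Set
Shape s t = Fin s → Fin t → Bool

record IsMoonPolyomino {s t : ℕ} (T : Shape s t) : Set where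
  field
    rowNonempty : ∀ i → ∃[ j ] T i j ≡ true
    colNonempty : ∀ j → ∃[ i ] T i j ≡ true
    rowConvex : ∀ i {j₁ j₂ j : Fin t} → T i j₁ ≡ true → T i j₂ ≡ true →
                toℕ j₁ ≤ toℕ j → toℕ j ≤ toℕ j₂ → T i j ≡ true
    colConvex : ∀ j {i₁ i₂ i : Fin s} → T i₁ j ≡ true → T i₂ j ≡ true →
                toℕ i₁ ≤ toℕ i → toℕ i ≤ toℕ i₂ → T i j ≡ true
    rowsNested : ∀ i₁ i₂ → (∀ j → T i₁ j ≡ true → T i₂ j ≡ true)
                         ⊎ (∀ j → T i₂ j ≡ true → T i₁ j ≡ true)
    colsNested : ∀ j₁ j₂ → (∀ i → T i j₁ ≡ true → T i j₂ ≡ true)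
                         ⊎ (∀ i → T i j₂ ≡ true → T i j₁ ≡ true)

Array : ℕ → ℕ → Set
Array s t = Vec (Vec Bool t) s

entry : ∀ {s t} → Array s t → Fin s → Fin t → Bool
entry F i j = lookup (lookup F i) j

allVecs : ∀ {A : Set} (n : ℕ) → List A → List (Vec A n)
allVecs zero    xs = [] ∷ []
allVecs (suc n) xs = concatMap (λ x → map (x ∷_) (allVecs n xs)) xs

allArrays : (s t : ℕ) → List (Array s t)
allArrays s t = allVecs s (allVecs t (true ∷ false ∷ []))

countᵇ : ∀ {A : Set} → (A → Bool) → List A → ℕ
countᵇ p xs = sum (map (λ x → if p x then 1 else 0) xs)

allRows : (s : ℕ) → (Fin s → Bool) → Bool
allRows s p = all p (allFin s)

_⇔ᵇ_ : Bool → Bool → Bool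
a ⇔ᵇ b = if a then b else not b

-- F is a 01-filling of T : all 1-entries lie in cells of T
-- (so a 01-filling of T is identified with such an array)
isFilling : ∀ {s t} → Shape s t → Array s t → Bool
isFilling {s} {t} T F = allRows s (λ i → allRows t (λ j → not (entry F i j) ∨ T i j))

rowCount : ∀ {s t} → Array s t → Fin s → ℕ
rowCount {s} {t} F i = countᵇ (λ j → entry F i j) (allFin t)

colCount : ∀ {s t} → Array s t → Fin t → ℕ
colCount {s} {t} F j = countᵇ (λ i → entry F i j) (allFin s)

between : ∀ {n} → Fin n → Fin n → Fin n → Bool
between a x b = (toℕ a ≤ᵇ toℕ x) ∧ (toℕ x ≤ᵇ toℕ b)

rectIn : ∀ {s t} → Shape s t → Fin s → Fin s → Fin t → Fin t → Bool
rectIn {s} {t} T r₁ r₂ c₁ c₂ =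
  allRows s (λ r → allRows t (λ c → not (between r₁ r r₂ ∧ between c₁ c c₂) ∨ T r c))

Cell : ℕ → ℕ → Set
Cell s t = Fin s × Fin t

cells : (s t : ℕ) → List (Cell s t)
cells s t = concatMap (λ i → map (i ,_) (allFin t)) (allFin s)

cellPairs : (s t : ℕ) → List (Cell s t × Cell s t)
cellPairs s t = concatMap (λ x → map (x ,_) (cells s t)) (cells s t)

isAscent : ∀ {s t} → Shape s t → Array s t → Cell s t × Cell s t → Bool
isAscent T F ((i , j) , (i' , j')) =
  entry F i j ∧ entry F i' j' ∧ (toℕ i' <ᵇ toℕ i) ∧ (toℕ j <ᵇ toℕ j')
  ∧ rectIn T i' i j j'

isDescent : ∀ {s t} → Shape s t → Array s t → Cell s t × Cell s t → Bool
isDescent T F ((i , j) , (i' , j')) =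
  entry F i j ∧ entry F i' j' ∧ (toℕ i <ᵇ toℕ i') ∧ (toℕ j <ᵇ toℕ j')
  ∧ rectIn T i i' j j'

ne₂ : ∀ {s t} → Shape s t → Array s t → ℕ
ne₂ {s} {t} T F = countᵇ (isAscent T F) (cellPairs s t)

se₂ : ∀ {s t} → Shape s t → Array s t → ℕ
se₂ {s} {t} T F = countᵇ (isDescent T F) (cellPairs s t)

inNc : ∀ {s t} → Shape s t → Vec ℕ s → Array s t → Bool
inNc {s} {t} T m F =
  isFilling T F ∧ allRows t (λ j → colCount F j ≤ᵇ 1)
  ∧ allRows s (λ i → rowCount F i ≡ᵇ lookup m i)

inNcA : ∀ {s t} → Shape s t → Vec ℕ s → Subset t → Array s t → Bool
inNcA {s} {t} T m A F =
  inNc T m F ∧ allRows t (λ j → (colCount F j ≡ᵇ 0) ⇔ᵇ lookup A j)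

inNr : ∀ {s t} → Shape s t → Vec ℕ t → Array s t → Bool
inNr {s} {t} T n F =
  isFilling T F ∧ allRows s (λ i → rowCount F i ≤ᵇ 1)
  ∧ allRows t (λ j → colCount F j ≡ᵇ lookup n j)

inNrB : ∀ {s t} → Shape s t → Vec ℕ t → Subset s → Array s t → Bool
inNrB {s} {t} T n B F =
  inNr T n F ∧ allRows s (λ i → (rowCount F i ≡ᵇ 0) ⇔ᵇ lookup B i)

inNAB : ∀ {s t} → Shape s t → Subset t → Subset s → Array s t → Bool
inNAB {s} {t} T A B F =
  isFilling T F ∧ allRows s (λ i → rowCount F i ≤ᵇ 1)
  ∧ allRows t (λ j → colCount F j ≤ᵇ 1)
  ∧ allRows t (λ j → (colCount F j ≡ᵇ 0) ⇔ᵇ lookup A j)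
  ∧ allRows s (λ i → (rowCount F i ≡ᵇ 0) ⇔ᵇ lookup B i)

-- (ne₂, se₂) is symmetrically distributed over the set S of fillings:
-- for all a b, #{F ∈ S : ne₂ F = a, se₂ F = b} = #{F ∈ S : ne₂ F = b, se₂ F = a},
-- i.e. Σ_{F∈S} p^{ne₂ F} q^{se₂ F} = Σ_{F∈S} p^{se₂ F} q^{ne₂ F} coefficientwise.
SymDist : ∀ {s t} → Shape s t → (Array s t → Bool) → Set
SymDist {s} {t} T S = ∀ (a b : ℕ) →
  countᵇ (λ F → S F ∧ (ne₂ T F ≡ᵇ a) ∧ (se₂ T F ≡ᵇ b)) (allArrays s t)
  ≡ countᵇ (λ F → S F ∧ (ne₂ T F ≡ᵇ b) ∧ (se₂ T F ≡ᵇ a)) (allArrays s t)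

-- A filling with at most one 1 per column is recorded as a word: column j carries the row of
-- its 1, if any.  In a moon polyomino every column is an interval of rows, any two of them are
-- nested, and two 1s in rows x and y of columns j < j′ span a rectangle inside the polyomino iff
-- x lies in column j′ and y in column j; they form an ascent if y < x and a descent if x < y.
-- Let a be the largest top row of a column with at least two cells.  By nestedness every such
-- column contains the rows a and a + 1, so merging these two rows turns ne₂ into ne₂ of a
-- configuration with fewer rows plus the inversions of the subword of letters a, a + 1 in those
-- columns.  Applying the involution recursively to the merged configuration and refilling the
-- merged letters with the reversed subword yields an involution exchanging ne₂ and se₂ that keeps
-- every row count and the set of nonempty columns.  Transposition reduces the families with at
-- most one 1 per row to the column case.

module Submission where

open import Defs
open import Data.Bool using (Bool; true; false; _∧_; _∨_; not; if_then_else_) renaming (T to True)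
open import Data.Bool.ListAction using (and)
open import Data.Bool.Properties using (∧-comm; ∧-zeroʳ; ∧-identityʳ; ∨-zeroʳ)
open import Data.Empty using (⊥; ⊥-elim)
open import Data.Fin using (Fin; zero; suc; toℕ; fromℕ<)
open import Data.Fin.Properties using (toℕ<n; toℕ-fromℕ<)
open import Data.Fin.Subset using (Subset)
open import Data.List as L using (List; []; _∷_; _++_; [_]; concatMap; allFin; cartesianProductWith)
open import Data.List.Properties using (map-∘; map-cong; map-++; unfold-reverse; reverse-involutive; length-reverse)
open import Data.List.Membership.Propositional using (_∈_)
open import Data.List.Membership.Propositional.Properties using (∈-map⁺; ∈-cartesianProductWith⁺)
open import Data.List.Membership.Propositional.Properties.WithK using (unique∧set⇒bag)
open import Data.List.Relation.Binary.BagAndSetEquality using (∼bag⇒↭)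
open import Data.List.Relation.Binary.Permutation.Propositional using (_↭_; ↭-sym)
import Data.List.Relation.Binary.Permutation.Propositional.Properties as ↭
open import Data.List.Relation.Unary.All as All using (All)
open import Data.List.Relation.Unary.AllPairs using ([]; _∷_)
open import Data.List.Relation.Unary.Any using (here; there)
open import Data.List.Relation.Unary.Unique.Propositional using (Unique)
import Data.List.Relation.Unary.Unique.Propositional.Properties as Unique
open import Data.Maybe as M using (Maybe; just; nothing; is-just)
open import Data.Nat
open import Data.Nat.ListAction using (sum)
open import Data.Nat.ListAction.Properties using (sum-↭; sum-++)
open import Data.Nat.Properties
open import Algebra.Properties.CommutativeSemigroup +-commutativeSemigroup using (interchange; x∙yz≈y∙xz)
open import Algebra.Properties.Semiring.Sum +-*-semiring using (∑-comm; sum-cong-≗; *-distribˡ-sum; *-distribʳ-sum; sum-replicate-zero) renaming (sum to ∑)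
open import Data.Product using (_×_; _,_; proj₁; proj₂; Σ-syntax; ∃-syntax)
open import Data.Sum using (_⊎_; inj₁; inj₂; swap)
open import Data.Unit using (⊤; tt)
open import Data.Vec as V using (Vec; []; _∷_; lookup)
open import Data.Vec.Properties using (lookup-map; lookup∘tabulate; tabulate∘lookup; tabulate-cong; ∷-injectiveˡ; ∷-injectiveʳ)
open import Function using (_∘_; flip)
open import Function.Bundles using (mk⇔)
open import Relation.Binary.Definitions using (tri<; tri≈; tri>)
open import Relation.Binary.PropositionalEquality hiding ([_])
open import Relation.Nullary using (yes; no)

χ : Bool → ℕ
χ true  = 1
χ false = 0

if-χ : ∀ b → (if b then 1 else 0) ≡ χ b
if-χ true  = refl
if-χ false = refl

bool-ext : ∀ {a b : Bool} → (a ≡ true → b ≡ true) → (b ≡ true → a ≡ true) → a ≡ b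
bool-ext {false} {false} _ _ = refl
bool-ext {false} {true}  _ g = g refl
bool-ext {true}  {false} f _ = sym (f refl)
bool-ext {true}  {true}  _ _ = refl

true-or-false : ∀ b → b ≡ true ⊎ b ≡ false
true-or-false true  = inj₁ refl
true-or-false false = inj₂ refl

true≢false : true ≢ false
true≢false ()

≡true⇒True : ∀ {b} → b ≡ true → True b
≡true⇒True refl = tt

True⇒≡true : ∀ {b} → True b → b ≡ true
True⇒≡true {true} _ = refl

∧-trueˡ : ∀ {a b} → (a ∧ b) ≡ true → a ≡ true
∧-trueˡ {true} _ = refl

∧-trueʳ : ∀ {a b} → (a ∧ b) ≡ true → b ≡ true
∧-trueʳ {true} e = e

∧-true : ∀ {a b} → a ≡ true → b ≡ true → (a ∧ b) ≡ true
∧-true refl refl = refl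

≤ᵇ-true⇒≤ : ∀ {m n} → (m ≤ᵇ n) ≡ true → m ≤ n
≤ᵇ-true⇒≤ {m} {n} e = ≤ᵇ⇒≤ m n (≡true⇒True e)

≤⇒≤ᵇ-true : ∀ {m n} → m ≤ n → (m ≤ᵇ n) ≡ true
≤⇒≤ᵇ-true le = True⇒≡true (≤⇒≤ᵇ le)

≤ᵇ-false⇒> : ∀ {m n} → (m ≤ᵇ n) ≡ false → n < m
≤ᵇ-false⇒> {m} {n} e = ≰⇒> (λ le → true≢false (trans (sym (≤⇒≤ᵇ-true {m} {n} le)) e))

>⇒≤ᵇ-false : ∀ {m n} → n < m → (m ≤ᵇ n) ≡ false
>⇒≤ᵇ-false {m} {n} lt with m ≤ᵇ n in e
... | false = refl
... | true  = ⊥-elim (<⇒≱ lt (≤ᵇ-true⇒≤ e))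

<ᵇ-true⇒< : ∀ {m n} → (m <ᵇ n) ≡ true → m < n
<ᵇ-true⇒< {m} {n} e = <ᵇ⇒< m n (≡true⇒True e)

<⇒<ᵇ-true : ∀ {m n} → m < n → (m <ᵇ n) ≡ true
<⇒<ᵇ-true lt = True⇒≡true (<⇒<ᵇ lt)

<ᵇ-false⇒≥ : ∀ {m n} → (m <ᵇ n) ≡ false → n ≤ m
<ᵇ-false⇒≥ {m} {n} e = ≮⇒≥ (λ lt → true≢false (trans (sym (<⇒<ᵇ-true {m} {n} lt)) e))

≥⇒<ᵇ-false : ∀ {m n} → n ≤ m → (m <ᵇ n) ≡ false
≥⇒<ᵇ-false {m} {n} le with m <ᵇ n in e
... | false = refl
... | true  = ⊥-elim (≤⇒≯ le (<ᵇ-true⇒< e))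

<ᵇ-irrefl : ∀ n → (n <ᵇ n) ≡ false
<ᵇ-irrefl n = ≥⇒<ᵇ-false {n} {n} ≤-refl

≡ᵇ-true⇒≡ : ∀ {m n} → (m ≡ᵇ n) ≡ true → m ≡ n
≡ᵇ-true⇒≡ {m} {n} e = ≡ᵇ⇒≡ m n (≡true⇒True e)

≡⇒≡ᵇ-true : ∀ {m n} → m ≡ n → (m ≡ᵇ n) ≡ true
≡⇒≡ᵇ-true {m} {n} e = True⇒≡true (≡⇒≡ᵇ m n e)

≢⇒≡ᵇ-false : ∀ {m n} → m ≢ n → (m ≡ᵇ n) ≡ false
≢⇒≡ᵇ-false {m} {n} ne with m ≡ᵇ n in e
... | false = refl
... | true  = ⊥-elim (ne (≡ᵇ-true⇒≡ e))

-- Merging two adjacent rows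

Interval : Set
Interval = ℕ × ℕ

_∈ᵢ_ : ℕ → Interval → Bool
v ∈ᵢ (l , h) = (l ≤ᵇ v) ∧ (v ≤ᵇ h)

wide : Interval → Bool
wide (l , h) = l <ᵇ h

inPair : ℕ → ℕ → Bool
inPair a v = (a ≤ᵇ v) ∧ (v ≤ᵇ suc a)

merge : ℕ → ℕ → ℕ
merge a v = if v ≤ᵇ a then v else pred v

mergeᵢ : ℕ → Interval → Interval
mergeᵢ a (l , h) = (merge a l , merge a h)

∈ᵢ⁻ : ∀ {v l h} → v ∈ᵢ (l , h) ≡ true → l ≤ v × v ≤ h
∈ᵢ⁻ e = ≤ᵇ-true⇒≤ (∧-trueˡ e) , ≤ᵇ-true⇒≤ (∧-trueʳ e)

∈ᵢ⁺ : ∀ {v l h} → l ≤ v → v ≤ h → v ∈ᵢ (l , h) ≡ true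
∈ᵢ⁺ p q = ∧-true (≤⇒≤ᵇ-true p) (≤⇒≤ᵇ-true q)

inPair⁻ : ∀ {a v} → inPair a v ≡ true → a ≤ v × v ≤ suc a
inPair⁻ e = ≤ᵇ-true⇒≤ (∧-trueˡ e) , ≤ᵇ-true⇒≤ (∧-trueʳ e)

inPair⁺ : ∀ {a v} → a ≤ v → v ≤ suc a → inPair a v ≡ true
inPair⁺ p q = ∧-true (≤⇒≤ᵇ-true p) (≤⇒≤ᵇ-true q)

inPair-false⁻ : ∀ {a v} → inPair a v ≡ false → v < a ⊎ suc a < v
inPair-false⁻ {a} {v} e with a ≤ᵇ v in e₁
... | false = inj₁ (≤ᵇ-false⇒> e₁)
... | true  = inj₂ (≤ᵇ-false⇒> e)

merge-≤ : ∀ {a v} → v ≤ a → merge a v ≡ v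
merge-≤ le rewrite ≤⇒≤ᵇ-true le = refl

merge-> : ∀ {a v} → a < v → merge a v ≡ pred v
merge-> lt rewrite >⇒≤ᵇ-false lt = refl

merge-≤-id : ∀ a v → merge a v ≤ v
merge-≤-id a v with v ≤ᵇ a
... | true  = ≤-refl
... | false = pred-≤ v
  where
    pred-≤ : ∀ n → pred n ≤ n
    pred-≤ zero    = z≤n
    pred-≤ (suc n) = n≤1+n n

merge-inPair : ∀ {a v} → inPair a v ≡ true → merge a v ≡ a
merge-inPair {a} {v} e with inPair⁻ {a} {v} e | v ≤ᵇ a in e₁
... | p , _ | true  = ≤-antisym (≤ᵇ-true⇒≤ e₁) p
... | _ , q | false = ≤-antisym (pred-mono-≤ {v} {suc a} q) (pred-mono-≤ {suc a} {v} (≤ᵇ-false⇒> e₁))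

merge≡⇒inPair : ∀ {a v} → merge a v ≡ a → inPair a v ≡ true
merge≡⇒inPair {a} {v} e with v ≤ᵇ a in e₁
... | true  = inPair⁺ (≤-reflexive (sym e)) (≤-trans (≤ᵇ-true⇒≤ e₁) (n≤1+n a))
... | false = inPair⁺ (<⇒≤ a<v) (≤-reflexive (trans (sym (suc-pred v {{>-nonZero (≤-<-trans z≤n a<v)}})) (cong suc e)))
  where
    a<v : a < v
    a<v = ≤ᵇ-false⇒> e₁

merge-mono-≤ : ∀ a {u v} → u ≤ v → merge a u ≤ merge a v
merge-mono-≤ a {u} {v} le with u ≤ᵇ a in e₁ | v ≤ᵇ a in e₂
... | true  | true  = le
... | true  | false = ≤-trans (≤ᵇ-true⇒≤ e₁) (pred-mono-≤ {suc a} {v} (≤ᵇ-false⇒> e₂))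
... | false | true  = ⊥-elim (<⇒≱ (≤ᵇ-false⇒> e₁) (≤-trans le (≤ᵇ-true⇒≤ e₂)))
... | false | false = pred-mono-≤ le

merge-mono-< : ∀ a {u v} → inPair a u ≡ false ⊎ inPair a v ≡ false → u < v → merge a u < merge a v
merge-mono-< a {u} {v} outside lt with u ≤ᵇ a in e₁ | v ≤ᵇ a in e₂
... | true  | true  = lt
... | false | true  = ⊥-elim (<⇒≱ (≤ᵇ-false⇒> e₁) (≤-trans (<⇒≤ lt) (≤ᵇ-true⇒≤ e₂)))
... | false | false = pred-mono-< {{>-nonZero (≤-<-trans z≤n (≤ᵇ-false⇒> e₁))}} lt
... | true  | false with v ≟ suc a | u ≟ a
...   | no v≢1+a | _ = ≤-trans (s≤s (≤ᵇ-true⇒≤ e₁)) (pred-mono-≤ {suc (suc a)} {v} (≤∧≢⇒< (≤ᵇ-false⇒> e₂) (v≢1+a ∘ sym)))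
...   | yes v≡1+a | no u≢a = subst (u <_) (cong pred (sym v≡1+a)) (≤∧≢⇒< (≤ᵇ-true⇒≤ e₁) u≢a)
...   | yes refl | yes refl with outside
...     | inj₁ e = ⊥-elim (true≢false (trans (sym (inPair⁺ {u} {u} ≤-refl (n≤1+n u))) e))
...     | inj₂ e = ⊥-elim (true≢false (trans (sym (inPair⁺ {u} {suc u} (n≤1+n u) ≤-refl)) e))

<ᵇ-merge : ∀ a u v → inPair a u ≡ false ⊎ inPair a v ≡ false → (merge a u <ᵇ merge a v) ≡ (u <ᵇ v)
<ᵇ-merge a u v outside = bool-ext (<⇒<ᵇ-true ∘ reflect ∘ <ᵇ-true⇒<) (<⇒<ᵇ-true ∘ merge-mono-< a outside ∘ <ᵇ-true⇒<)
  where
    reflect : merge a u < merge a v → u < v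
    reflect p with u <? v
    ... | yes q = q
    ... | no q  = ⊥-elim (<⇒≱ p (merge-mono-≤ a (≮⇒≥ q)))

∈ᵢ-merge : ∀ {a v} I → inPair a v ≡ false → merge a v ∈ᵢ mergeᵢ a I ≡ v ∈ᵢ I
∈ᵢ-merge {a} {v} (l , h) outside = bool-ext reflect (λ e → let p , q = ∈ᵢ⁻ {v} {l} {h} e in ∈ᵢ⁺ (merge-mono-≤ a p) (merge-mono-≤ a q))
  where
    reflect : merge a v ∈ᵢ mergeᵢ a (l , h) ≡ true → v ∈ᵢ (l , h) ≡ true
    reflect e with ∈ᵢ⁻ {merge a v} {merge a l} {merge a h} e
    ... | p , q = ∈ᵢ⁺ {v} {l} {h} (≮⇒≥ (λ v<l → <⇒≱ (merge-mono-< a {v} {l} (inj₁ outside) v<l) p))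
                                (≮⇒≥ (λ h<v → <⇒≱ (merge-mono-< a {h} {v} (inj₂ outside) h<v) q))

Straddles : ℕ → Interval → Set
Straddles a I = wide I ≡ true → proj₁ I ≤ a × suc a ≤ proj₂ I

inPair-∈ᵢ : ∀ {a v l h} → inPair a v ≡ true → l ≤ a → suc a ≤ h → v ∈ᵢ (l , h) ≡ true
inPair-∈ᵢ {a} {v} e p q with inPair⁻ {a} {v} e
... | r , s = ∈ᵢ⁺ (≤-trans p r) (≤-trans s q)

inPair-∈ᵢ-merge : ∀ {a v l h} → inPair a v ≡ true → l ≤ a → suc a ≤ h → merge a v ∈ᵢ mergeᵢ a (l , h) ≡ true
inPair-∈ᵢ-merge {a} {v} {l} {h} e p q rewrite merge-inPair {a} {v} e =
  ∈ᵢ⁺ (subst (merge a l ≤_) (merge-≤ {a} {a} ≤-refl) (merge-mono-≤ a p))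
      (subst (_≤ merge a h) (merge-inPair {a} {suc a} (inPair⁺ (n≤1+n a) ≤-refl)) (merge-mono-≤ a q))

narrow-∈ᵢ-unique : ∀ {x y l h} → wide (l , h) ≡ false → x ∈ᵢ (l , h) ≡ true → y ∈ᵢ (l , h) ≡ true → y ≡ x
narrow-∈ᵢ-unique {x} {y} {l} {h} d ex ey with ∈ᵢ⁻ {x} {l} {h} ex | ∈ᵢ⁻ {y} {l} {h} ey
... | p , q | r , s = ≤-antisym (≤-trans s (≤-trans (<ᵇ-false⇒≥ d) p)) (≤-trans q (≤-trans (<ᵇ-false⇒≥ d) r))

-- A wide J straddles the pair; a narrow J holding y ∉ {a, a + 1} can hold no letter of the pair.
∈ᵢ-merge-inPair : ∀ {a x y} J → inPair a x ≡ true → inPair a y ≡ false → y ∈ᵢ J ≡ true → Straddles a J →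
                  merge a x ∈ᵢ mergeᵢ a J ≡ x ∈ᵢ J
∈ᵢ-merge-inPair {a} {x} {y} (l , h) px py yJ st with l <ᵇ h in lh
... | true  = trans (inPair-∈ᵢ-merge {a} {x} px (proj₁ (st refl)) (proj₂ (st refl)))
                    (sym (inPair-∈ᵢ {a} {x} px (proj₁ (st refl)) (proj₂ (st refl))))
... | false = bool-ext (⊥-elim ∘ merged) (⊥-elim ∘ original)
  where
    original : x ∈ᵢ (l , h) ≡ true → ⊥
    original e = true≢false (trans (sym px) (subst (λ z → inPair a z ≡ false) (sym (narrow-∈ᵢ-unique {y} {x} {l} {h} lh yJ e)) py))
    merged : merge a x ∈ᵢ mergeᵢ a (l , h) ≡ true → ⊥
    merged e with ∈ᵢ⁻ {merge a x} {merge a l} {merge a h} e | ∈ᵢ⁻ {y} {l} {h} yJ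
    ... | p , q | r , s = true≢false (trans (sym (merge≡⇒inPair {a} {y} merge-y)) py)
      where
        l≡h : l ≡ h
        l≡h = ≤-antisym (≤-trans r s) (<ᵇ-false⇒≥ lh)
        y≡l : y ≡ l
        y≡l = ≤-antisym (≤-trans s (≤-reflexive (sym l≡h))) r
        merge-y : merge a y ≡ a
        merge-y = ≤-antisym (subst (λ z → merge a z ≤ a) (sym y≡l) (subst (merge a l ≤_) (merge-inPair {a} {x} px) p))
                            (subst (λ z → a ≤ merge a z) (trans (sym l≡h) (sym y≡l)) (subst (_≤ merge a h) (merge-inPair {a} {x} px) q))

-- Crossings of words over row intervals

Relᵇ : Set
Relᵇ = ℕ → ℕ → Bool

Word : ℕ → Set
Word n = Vec (Maybe ℕ) n

-- Column j of a word carries the row of its 1, if any.  The letters x of a column with rows I and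
-- y of a later column with rows J span a rectangle inside a moon polyomino iff x ∈ J and y ∈ I.
crossing : Relᵇ → Interval → Maybe ℕ → Interval → Maybe ℕ → Bool
crossing c I (just x) J (just y) = c y x ∧ x ∈ᵢ J ∧ y ∈ᵢ I
crossing c I (just x) J nothing  = false
crossing c I nothing  J y        = false

value : Maybe ℕ → ℕ
value (just v) = v
value nothing  = 0

selected : ℕ → Interval → Maybe ℕ → Bool
selected a I (just v) = wide I ∧ inPair a v
selected a I nothing  = false

Fits : Interval → Maybe ℕ → Set
Fits I nothing  = ⊤
Fits I (just v) = v ∈ᵢ I ≡ true

mergeₘ : ℕ → Maybe ℕ → Maybe ℕ
mergeₘ a = M.map (merge a)

record MergeInvariant (c : Relᵇ) : Set where
  field
    irrefl    : ∀ u → c u u ≡ false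
    merge-inv : ∀ a u v → inPair a u ≡ false ⊎ inPair a v ≡ false → c (merge a u) (merge a v) ≡ c u v
open MergeInvariant

<ᵇ-mergeInvariant : MergeInvariant _<ᵇ_
<ᵇ-mergeInvariant = record { irrefl = <ᵇ-irrefl ; merge-inv = <ᵇ-merge }

>ᵇ-mergeInvariant : MergeInvariant (flip _<ᵇ_)
>ᵇ-mergeInvariant = record { irrefl = <ᵇ-irrefl ; merge-inv = λ a u v outside → <ᵇ-merge a v u (swap outside) }

pairCrossing : Relᵇ → ℕ → Interval → Maybe ℕ → Interval → Maybe ℕ → Bool
pairCrossing c a I x J y = selected a I x ∧ selected a J y ∧ c (value y) (value x)

selected-outside : ∀ a I v → inPair a v ≡ false → selected a I (just v) ≡ false
selected-outside a I v e rewrite e = ∧-zeroʳ (wide I)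

pairCrossing-outside : ∀ c a I x J y → inPair a x ≡ false ⊎ inPair a y ≡ false →
                       pairCrossing c a I (just x) J (just y) ≡ false
pairCrossing-outside c a I x J y (inj₁ e) rewrite selected-outside a I x e = refl
pairCrossing-outside c a I x J y (inj₂ e) rewrite selected-outside a J y e = ∧-zeroʳ (selected a I (just x))

crossing-narrowˡ : ∀ {c} → (∀ u → c u u ≡ false) → ∀ I x J y → wide I ≡ false → Fits I x → crossing c I x J y ≡ false
crossing-narrowˡ irr I nothing J y d o = refl
crossing-narrowˡ irr I (just x) J nothing d o = refl
crossing-narrowˡ {c} irr (l , h) (just x) J (just y) d o with y ∈ᵢ (l , h) in yI
... | false rewrite ∧-zeroʳ (x ∈ᵢ J) | ∧-zeroʳ (c y x) = refl
... | true  rewrite narrow-∈ᵢ-unique {x} {y} {l} {h} d o yI | irr x = refl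

crossing-narrowʳ : ∀ {c} → (∀ u → c u u ≡ false) → ∀ I x J y → wide J ≡ false → Fits J y → crossing c I x J y ≡ false
crossing-narrowʳ irr I nothing J y d o = refl
crossing-narrowʳ irr I (just x) J nothing d o = refl
crossing-narrowʳ {c} irr I (just x) (l , h) (just y) d o with x ∈ᵢ (l , h) in xJ
... | false = ∧-zeroʳ (c y x)
... | true  rewrite narrow-∈ᵢ-unique {y} {x} {l} {h} d o xJ | irr y = refl

crossing-merge-inPair : ∀ {c} → MergeInvariant c → ∀ a I x J y → inPair a x ≡ true → inPair a y ≡ true →
  Fits I (just x) → Fits J (just y) → Straddles a I → Straddles a J →
  χ (crossing c I (just x) J (just y))
  ≡ χ (crossing c (mergeᵢ a I) (just (merge a x)) (mergeᵢ a J) (just (merge a y))) + χ (pairCrossing c a I (just x) J (just y))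
crossing-merge-inPair {c} L a I x J y px py oI oJ sI sJ
  rewrite merge-inPair {a} {x} px | merge-inPair {a} {y} py | irrefl L a | px | py
  with wide I in wI | wide J in wJ
... | true  | true  rewrite inPair-∈ᵢ {a} {x} px (proj₁ (sJ refl)) (proj₂ (sJ refl))
                          | inPair-∈ᵢ {a} {y} py (proj₁ (sI refl)) (proj₂ (sI refl)) | ∧-identityʳ (c y x) = refl
... | false | _     = cong χ (crossing-narrowˡ {c} (irrefl L) I (just x) J (just y) wI oI)
... | true  | false = cong χ (crossing-narrowʳ {c} (irrefl L) I (just x) J (just y) wJ oJ)

crossing-merge-outside : ∀ {c} → MergeInvariant c → ∀ a I x J y → inPair a x ≡ false ⊎ inPair a y ≡ false →
  merge a x ∈ᵢ mergeᵢ a J ≡ x ∈ᵢ J → merge a y ∈ᵢ mergeᵢ a I ≡ y ∈ᵢ I →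
  χ (crossing c I (just x) J (just y))
  ≡ χ (crossing c (mergeᵢ a I) (just (merge a x)) (mergeᵢ a J) (just (merge a y))) + χ (pairCrossing c a I (just x) J (just y))
crossing-merge-outside {c} L a I x J y outside ex ey
  rewrite merge-inv L a y x (swap outside) | ex | ey | pairCrossing-outside c a I x J y outside = sym (+-identityʳ _)

crossing-merge : ∀ {c} → MergeInvariant c → ∀ a I x J y → Fits I x → Fits J y → Straddles a I → Straddles a J →
  χ (crossing c I x J y) ≡ χ (crossing c (mergeᵢ a I) (mergeₘ a x) (mergeᵢ a J) (mergeₘ a y)) + χ (pairCrossing c a I x J y)
crossing-merge L a I nothing J y oI oJ sI sJ = refl
crossing-merge L a I (just x) J nothing oI oJ sI sJ rewrite ∧-zeroʳ (wide I ∧ inPair a x) = refl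
crossing-merge L a I (just x) J (just y) oI oJ sI sJ with true-or-false (inPair a x) | true-or-false (inPair a y)
... | inj₁ px | inj₁ py = crossing-merge-inPair L a I x J y px py oI oJ sI sJ
... | inj₁ px | inj₂ py = crossing-merge-outside L a I x J y (inj₂ py) (∈ᵢ-merge-inPair {a} {x} {y} J px py oJ sJ) (∈ᵢ-merge {a} {y} I py)
... | inj₂ px | inj₁ py = crossing-merge-outside L a I x J y (inj₁ px) (∈ᵢ-merge {a} {x} J px) (∈ᵢ-merge-inPair {a} {y} {x} I py px oI sI)
... | inj₂ px | inj₂ py = crossing-merge-outside L a I x J y (inj₁ px) (∈ᵢ-merge {a} {x} J px) (∈ᵢ-merge {a} {y} I py)

crossingsFrom : ∀ {n} → Relᵇ → Interval → Maybe ℕ → Vec Interval n → Word n → ℕ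
crossingsFrom c I x []       []       = 0
crossingsFrom c I x (J ∷ Is) (y ∷ ys) = χ (crossing c I x J y) + crossingsFrom c I x Is ys

crossings : ∀ {n} → Relᵇ → Vec Interval n → Word n → ℕ
crossings c []       []       = 0
crossings c (I ∷ Is) (x ∷ xs) = crossingsFrom c I x Is xs + crossings c Is xs

pairWord : ∀ {n} → ℕ → Vec Interval n → Word n → List ℕ
pairWord a []       []       = []
pairWord a (I ∷ Is) (x ∷ xs) = if selected a I x then value x ∷ pairWord a Is xs else pairWord a Is xs

countRel : Relᵇ → ℕ → List ℕ → ℕ
countRel c v []       = 0
countRel c v (y ∷ ys) = χ (c y v) + countRel c v ys

inversions : Relᵇ → List ℕ → ℕ
inversions c []       = 0
inversions c (v ∷ ws) = countRel c v ws + inversions c ws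

mergeʷ : ∀ {n} → ℕ → Word n → Word n
mergeʷ a = V.map (mergeₘ a)

mergeᵛ : ∀ {n} → ℕ → Vec Interval n → Vec Interval n
mergeᵛ a = V.map (mergeᵢ a)

AllFit : ∀ {n} → Vec Interval n → Word n → Set
AllFit Is xs = ∀ i → Fits (lookup Is i) (lookup xs i)

AllStraddle : ∀ {n} → ℕ → Vec Interval n → Set
AllStraddle a Is = ∀ i → Straddles a (lookup Is i)

crossingsFrom-merge : ∀ {c} → MergeInvariant c → ∀ a {n} I x (Is : Vec Interval n) xs →
  Fits I x → Straddles a I → AllFit Is xs → AllStraddle a Is →
  crossingsFrom c I x Is xs
  ≡ crossingsFrom c (mergeᵢ a I) (mergeₘ a x) (mergeᵛ a Is) (mergeʷ a xs)
    + (if selected a I x then countRel c (value x) (pairWord a Is xs) else 0)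
crossingsFrom-merge L a I x [] [] oI sI o s with selected a I x
... | true  = refl
... | false = refl
crossingsFrom-merge {c} L a I x (J ∷ Js) (y ∷ ys) oI sI o s
  rewrite crossing-merge L a I x J y oI (o zero) sI (s zero)
        | crossingsFrom-merge L a I x Js ys oI sI (o ∘ suc) (s ∘ suc)
  with selected a I x
... | false = interchange (χ (crossing c (mergeᵢ a I) (mergeₘ a x) (mergeᵢ a J) (mergeₘ a y))) 0 _ 0
... | true with selected a J y
...   | true  = interchange (χ (crossing c (mergeᵢ a I) (mergeₘ a x) (mergeᵢ a J) (mergeₘ a y))) (χ (c (value y) (value x))) _ _
...   | false = interchange (χ (crossing c (mergeᵢ a I) (mergeₘ a x) (mergeᵢ a J) (mergeₘ a y))) 0 _ _

crossings-merge : ∀ {c} → MergeInvariant c → ∀ a {n} (Is : Vec Interval n) xs → AllFit Is xs → AllStraddle a Is →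
  crossings c Is xs ≡ crossings c (mergeᵛ a Is) (mergeʷ a xs) + inversions c (pairWord a Is xs)
crossings-merge L a [] [] o s = refl
crossings-merge {c} L a (I ∷ Is) (x ∷ xs) o s
  rewrite crossingsFrom-merge L a I x Is xs (o zero) (s zero) (o ∘ suc) (s ∘ suc)
        | crossings-merge L a Is xs (o ∘ suc) (s ∘ suc)
  with selected a I x
... | true  = interchange (crossingsFrom c (mergeᵢ a I) (mergeₘ a x) (mergeᵛ a Is) (mergeʷ a xs)) _ _ _
... | false = interchange (crossingsFrom c (mergeᵢ a I) (mergeₘ a x) (mergeᵛ a Is) (mergeʷ a xs)) 0 _ _

countRel-++ : ∀ c v xs ys → countRel c v (xs ++ ys) ≡ countRel c v xs + countRel c v ys
countRel-++ c v []       ys = refl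
countRel-++ c v (x ∷ xs) ys rewrite countRel-++ c v xs ys = sym (+-assoc (χ (c x v)) _ _)

countRel-reverse : ∀ c v xs → countRel c v (L.reverse xs) ≡ countRel c v xs
countRel-reverse c v []       = refl
countRel-reverse c v (x ∷ xs)
  rewrite unfold-reverse x xs | countRel-++ c v (L.reverse xs) [ x ] | countRel-reverse c v xs
        | +-identityʳ (χ (c x v)) = +-comm (countRel c v xs) (χ (c x v))

inversions-∷ʳ : ∀ c xs x → inversions c (xs ++ [ x ]) ≡ inversions c xs + countRel (flip c) x xs
inversions-∷ʳ c []       x = refl
inversions-∷ʳ c (v ∷ ws) x
  rewrite countRel-++ c v ws [ x ] | inversions-∷ʳ c ws x | +-identityʳ (χ (c x v))
  = interchange (countRel c v ws) (χ (c x v)) (inversions c ws) (countRel (flip c) x ws)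

inversions-reverse : ∀ c xs → inversions c (L.reverse xs) ≡ inversions (flip c) xs
inversions-reverse c []       = refl
inversions-reverse c (x ∷ xs)
  rewrite unfold-reverse x xs | inversions-∷ʳ c (L.reverse xs) x | inversions-reverse c xs | countRel-reverse (flip c) x xs
  = +-comm (inversions (flip c) xs) _

-- Popping from an empty list is never needed (see pairWord-refill); it returns a junk letter a.
pop : ℕ → List ℕ → Maybe ℕ × List ℕ
pop a []       = (just a , [])
pop a (v ∷ ws) = (just v , ws)

refillStep : ℕ → Maybe ℕ → List ℕ → Maybe ℕ × List ℕ
refillStep a nothing  ws = (nothing , ws)
refillStep a (just u) ws = if u <ᵇ a then (just u , ws) else (if a <ᵇ u then (just (suc u) , ws) else pop a ws)

-- Undoes mergeʷ on the wide columns, replacing the merged letters a by the successive letters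
-- of ws; the narrow columns are copied from xs.
refill : ∀ {n} → ℕ → Vec Interval n → Word n → Word n → List ℕ → Word n
refill a []       []       []       ws = []
refill a (I ∷ Is) (x ∷ xs) (r ∷ rs) ws =
  if wide I then proj₁ (refillStep a r ws) ∷ refill a Is xs rs (proj₂ (refillStep a r ws))
            else x ∷ refill a Is xs rs ws

refillStep-< : ∀ {a u} ws → u < a → refillStep a (just u) ws ≡ (just u , ws)
refillStep-< ws p rewrite <⇒<ᵇ-true p = refl

refillStep-> : ∀ {a u} ws → a < u → refillStep a (just u) ws ≡ (just (suc u) , ws)
refillStep-> {a} {u} ws p rewrite ≥⇒<ᵇ-false {u} {a} (<⇒≤ p) | <⇒<ᵇ-true p = refl

refillStep-≡ : ∀ a ws → refillStep a (just a) ws ≡ pop a ws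
refillStep-≡ a ws rewrite <ᵇ-irrefl a = refl

AllInPair : ℕ → List ℕ → Set
AllInPair a = All (λ v → inPair a v ≡ true)

hasLetter : ℕ → Maybe ℕ → Bool
hasLetter v (just u) = u ≡ᵇ v
hasLetter v nothing  = false

wideOccurrences : ∀ {n} → ℕ → Vec Interval n → Word n → ℕ
wideOccurrences a []       []       = 0
wideOccurrences a (I ∷ Is) (r ∷ rs) = (if wide I then χ (hasLetter a r) else 0) + wideOccurrences a Is rs

AgreeOnNarrow : ∀ {n} → Vec Interval n → Word n → Word n → Set
AgreeOnNarrow Is xs ys = ∀ i → wide (lookup Is i) ≡ false → lookup xs i ≡ lookup ys i

selected-narrow : ∀ a I x → wide I ≡ false → selected a I x ≡ false
selected-narrow a I nothing  e = refl
selected-narrow a I (just v) e rewrite e = refl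

selected-wide : ∀ a I v → wide I ≡ true → selected a I (just v) ≡ inPair a v
selected-wide a I v e rewrite e = refl

refill-merge : ∀ a {n} (Is : Vec Interval n) xs → refill a Is xs (mergeʷ a xs) (pairWord a Is xs) ≡ xs
refill-merge a [] [] = refl
refill-merge a (I ∷ Is) (x ∷ xs) with wide I in wI
refill-merge a (I ∷ Is) (nothing ∷ xs) | false = cong (nothing ∷_) (refill-merge a Is xs)
refill-merge a (I ∷ Is) (just v ∷ xs)  | false rewrite selected-narrow a I (just v) wI = cong (just v ∷_) (refill-merge a Is xs)
refill-merge a (I ∷ Is) (nothing ∷ xs) | true = cong (nothing ∷_) (refill-merge a Is xs)
refill-merge a (I ∷ Is) (just v ∷ xs)  | true rewrite selected-wide a I v wI with inPair a v in pv
... | true rewrite merge-inPair {a} {v} pv | refillStep-≡ a (v ∷ pairWord a Is xs) = cong (just v ∷_) (refill-merge a Is xs)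
... | false with inPair-false⁻ {a} {v} pv
...   | inj₁ p rewrite merge-≤ {a} {v} (<⇒≤ p) | refillStep-< {a} {v} (pairWord a Is xs) p = cong (just v ∷_) (refill-merge a Is xs)
...   | inj₂ p rewrite merge-> {a} {v} (≤-trans (n≤1+n _) p) | refillStep-> {a} {pred v} (pairWord a Is xs) (pred-mono-≤ {suc (suc a)} {v} p)
        = cong₂ _∷_ (cong just (suc-pred v {{>-nonZero (≤-trans (s≤s z≤n) p)}})) (refill-merge a Is xs)

mergeʷ-refill : ∀ a {n} (Is : Vec Interval n) xs rs ws → AgreeOnNarrow Is rs (mergeʷ a xs) → AllInPair a ws →
                mergeʷ a (refill a Is xs rs ws) ≡ rs
mergeʷ-refill a [] [] [] ws ag ps = refl
mergeʷ-refill a (I ∷ Is) (x ∷ xs) (r ∷ rs) ws ag ps with wide I in wI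
... | false = cong₂ _∷_ (sym (ag zero wI)) (mergeʷ-refill a Is xs rs ws (ag ∘ suc) ps)
mergeʷ-refill a (I ∷ Is) (x ∷ xs) (nothing ∷ rs) ws ag ps | true = cong (nothing ∷_) (mergeʷ-refill a Is xs rs ws (ag ∘ suc) ps)
mergeʷ-refill a (I ∷ Is) (x ∷ xs) (just u ∷ rs) ws ag ps | true with <-cmp u a
... | tri< p _ _ rewrite refillStep-< ws p = cong₂ _∷_ (cong just (merge-≤ (<⇒≤ p))) (mergeʷ-refill a Is xs rs ws (ag ∘ suc) ps)
... | tri> _ _ p rewrite refillStep-> ws p = cong₂ _∷_ (cong just (merge-> {a} {suc u} (≤-trans p (n≤1+n u)))) (mergeʷ-refill a Is xs rs ws (ag ∘ suc) ps)
mergeʷ-refill a (I ∷ Is) (x ∷ xs) (just u ∷ rs) [] ag ps | true | tri≈ _ refl _ rewrite refillStep-≡ u [] =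
  cong₂ _∷_ (cong just (merge-≤ {u} {u} ≤-refl)) (mergeʷ-refill u Is xs rs [] (ag ∘ suc) ps)
mergeʷ-refill a (I ∷ Is) (x ∷ xs) (just u ∷ rs) (w ∷ ws) ag (p All.∷ ps) | true | tri≈ _ refl _ rewrite refillStep-≡ u (w ∷ ws) =
  cong₂ _∷_ (cong just (merge-inPair p)) (mergeʷ-refill u Is xs rs ws (ag ∘ suc) ps)

≡ᵇ-refl : ∀ m → (m ≡ᵇ m) ≡ true
≡ᵇ-refl m = ≡⇒≡ᵇ-true {m} {m} refl

pairWord-refill : ∀ a {n} (Is : Vec Interval n) xs rs ws → L.length ws ≡ wideOccurrences a Is rs → AllInPair a ws →
                  pairWord a Is (refill a Is xs rs ws) ≡ ws
pairWord-refill a [] [] [] [] len ps = refl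
pairWord-refill a (I ∷ Is) (x ∷ xs) (r ∷ rs) ws len ps with wide I in wI
pairWord-refill a (I ∷ Is) (nothing ∷ xs) (r ∷ rs) ws len ps | false = pairWord-refill a Is xs rs ws len ps
pairWord-refill a (I ∷ Is) (just v ∷ xs) (r ∷ rs) ws len ps | false rewrite selected-narrow a I (just v) wI = pairWord-refill a Is xs rs ws len ps
pairWord-refill a (I ∷ Is) (x ∷ xs) (nothing ∷ rs) ws len ps | true = pairWord-refill a Is xs rs ws len ps
pairWord-refill a (I ∷ Is) (x ∷ xs) (just u ∷ rs) ws len ps | true with <-cmp u a
... | tri< p _ _ rewrite refillStep-< ws p | selected-wide a I u wI | >⇒≤ᵇ-false {a} {u} p | ≢⇒≡ᵇ-false (<⇒≢ p) =
  pairWord-refill a Is xs rs ws len ps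
... | tri> _ _ p rewrite refillStep-> ws p | selected-wide a I (suc u) wI | ≤⇒≤ᵇ-true {a} {suc u} (≤-trans (<⇒≤ p) (n≤1+n u))
                       | >⇒≤ᵇ-false {suc u} {suc a} (s≤s p) | ≢⇒≡ᵇ-false (<⇒≢ p ∘ sym) = pairWord-refill a Is xs rs ws len ps
pairWord-refill a (I ∷ Is) (x ∷ xs) (just u ∷ rs) (w ∷ ws) len (p All.∷ ps) | true | tri≈ _ refl _
  rewrite refillStep-≡ u (w ∷ ws) | selected-wide u I w wI | p | ≡ᵇ-refl u = cong (w ∷_) (pairWord-refill u Is xs rs ws (suc-injective len) ps)
pairWord-refill a (I ∷ Is) (x ∷ xs) (just u ∷ rs) [] len ps | true | tri≈ _ refl _ rewrite ≡ᵇ-refl u with len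
... | ()

refill-fits : ∀ a {n} (Is : Vec Interval n) xs rs ws → AllFit Is xs → AllFit (mergeᵛ a Is) rs → AllInPair a ws →
              AllStraddle a Is → AllFit Is (refill a Is xs rs ws)
refill-fits a (I ∷ Is) (x ∷ xs) (r ∷ rs) ws ox or ps st i with wide I in wI
refill-fits a (I ∷ Is) (x ∷ xs) (r ∷ rs) ws ox or ps st zero    | false = ox zero
refill-fits a (I ∷ Is) (x ∷ xs) (r ∷ rs) ws ox or ps st (suc i) | false = refill-fits a Is xs rs ws (ox ∘ suc) (or ∘ suc) ps (st ∘ suc) i
refill-fits a (I ∷ Is) (x ∷ xs) (nothing ∷ rs) ws ox or ps st zero    | true = tt
refill-fits a (I ∷ Is) (x ∷ xs) (nothing ∷ rs) ws ox or ps st (suc i) | true = refill-fits a Is xs rs ws (ox ∘ suc) (or ∘ suc) ps (st ∘ suc) i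
refill-fits a ((l , h) ∷ Is) (x ∷ xs) (just u ∷ rs) ws ox or ps st i | true
  with <-cmp u a | st zero wI | ∈ᵢ⁻ {u} {merge a l} {merge a h} (or zero)
... | tri< p _ _ | l≤a , a<h | p₁ , p₂ rewrite refillStep-< ws p with i
...   | zero  = ∈ᵢ⁺ (subst (_≤ u) (merge-≤ l≤a) p₁) (≤-trans p₂ (merge-≤-id a h))
...   | suc j = refill-fits a Is xs rs ws (ox ∘ suc) (or ∘ suc) ps (st ∘ suc) j
refill-fits a ((l , h) ∷ Is) (x ∷ xs) (just u ∷ rs) ws ox or ps st i | true | tri> _ _ p | l≤a , a<h | p₁ , p₂
  rewrite refillStep-> ws p with i
...   | zero  = ∈ᵢ⁺ (≤-trans l≤a (≤-trans (<⇒≤ p) (n≤1+n u)))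
                    (subst (suc u ≤_) (suc-pred h {{>-nonZero (≤-trans (s≤s z≤n) a<h)}}) (s≤s (subst (u ≤_) (merge-> {a} {h} a<h) p₂)))
...   | suc j = refill-fits a Is xs rs ws (ox ∘ suc) (or ∘ suc) ps (st ∘ suc) j
refill-fits a ((l , h) ∷ Is) (x ∷ xs) (just u ∷ rs) [] ox or ps st i | true | tri≈ _ refl _ | l≤a , a<h | _
  rewrite refillStep-≡ u [] with i
...   | zero  = inPair-∈ᵢ {u} {u} (inPair⁺ ≤-refl (n≤1+n u)) l≤a a<h
...   | suc j = refill-fits u Is xs rs [] (ox ∘ suc) (or ∘ suc) ps (st ∘ suc) j
refill-fits a ((l , h) ∷ Is) (x ∷ xs) (just u ∷ rs) (w ∷ ws) ox or (p All.∷ ps) st i | true | tri≈ _ refl _ | l≤a , a<h | _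
  rewrite refillStep-≡ u (w ∷ ws) with i
...   | zero  = inPair-∈ᵢ {u} {w} p l≤a a<h
...   | suc j = refill-fits u Is xs rs ws (ox ∘ suc) (or ∘ suc) ps (st ∘ suc) j

refill-agrees : ∀ a {n} (Is : Vec Interval n) xs rs ws → AgreeOnNarrow Is (refill a Is xs rs ws) xs
refill-agrees a (I ∷ Is) (x ∷ xs) (r ∷ rs) ws i n with wide I in wI
refill-agrees a (I ∷ Is) (x ∷ xs) (r ∷ rs) ws zero    n | false = refl
refill-agrees a (I ∷ Is) (x ∷ xs) (r ∷ rs) ws (suc i) n | false = refill-agrees a Is xs rs ws i n
refill-agrees a (I ∷ Is) (x ∷ xs) (r ∷ rs) ws zero    n | true  = ⊥-elim (true≢false (trans (sym wI) n))
refill-agrees a (I ∷ Is) (x ∷ xs) (r ∷ rs) ws (suc i) n | true  = refill-agrees a Is xs rs _ i n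

refill-cong : ∀ a {n} (Is : Vec Interval n) ys xs rs ws → AgreeOnNarrow Is ys xs → refill a Is ys rs ws ≡ refill a Is xs rs ws
refill-cong a [] [] [] [] ws ag = refl
refill-cong a (I ∷ Is) (y ∷ ys) (x ∷ xs) (r ∷ rs) ws ag with wide I in wI
... | false = cong₂ _∷_ (ag zero wI) (refill-cong a Is ys xs rs ws (ag ∘ suc))
... | true  = cong (_ ∷_) (refill-cong a Is ys xs rs _ (ag ∘ suc))

support : ∀ {n} → Word n → Vec Bool n
support = V.map is-just

support-merge : ∀ a {n} (xs : Word n) → support (mergeʷ a xs) ≡ support xs
support-merge a []            = refl
support-merge a (nothing ∷ xs) = cong (false ∷_) (support-merge a xs)
support-merge a (just x ∷ xs)  = cong (true ∷_) (support-merge a xs)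

occurrences : ∀ {n} → ℕ → Word n → ℕ
occurrences v []       = 0
occurrences v (x ∷ xs) = χ (hasLetter v x) + occurrences v xs

narrowOccurrences : ∀ {n} → ℕ → Vec Interval n → Word n → ℕ
narrowOccurrences v []       []       = 0
narrowOccurrences v (I ∷ Is) (x ∷ xs) = (if wide I then 0 else χ (hasLetter v x)) + narrowOccurrences v Is xs

occurrences-merge : ∀ a v {n} (xs : Word n) → inPair a v ≡ false → occurrences v xs ≡ occurrences (merge a v) (mergeʷ a xs)
occurrences-merge a v []             outside = refl
occurrences-merge a v (nothing ∷ xs) outside = occurrences-merge a v xs outside
occurrences-merge a v (just u ∷ xs)  outside = cong₂ _+_ (cong χ same) (occurrences-merge a v xs outside)
  where
    same : (u ≡ᵇ v) ≡ (merge a u ≡ᵇ merge a v)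
    same = bool-ext (λ e → ≡⇒≡ᵇ-true (cong (merge a) (≡ᵇ-true⇒≡ {u} {v} e))) reflect
      where
        reflect : (merge a u ≡ᵇ merge a v) ≡ true → (u ≡ᵇ v) ≡ true
        reflect e with <-cmp u v
        ... | tri< p _ _ = ⊥-elim (<⇒≢ (merge-mono-< a {u} {v} (inj₂ outside) p) (≡ᵇ-true⇒≡ e))
        ... | tri≈ _ p _ = ≡⇒≡ᵇ-true p
        ... | tri> _ _ p = ⊥-elim (<⇒≢ (merge-mono-< a {v} {u} (inj₁ outside) p) (sym (≡ᵇ-true⇒≡ e)))

occurrences-pairWord : ∀ a v {n} (Is : Vec Interval n) xs → inPair a v ≡ true →
  occurrences v xs ≡ countRel _≡ᵇ_ v (pairWord a Is xs) + narrowOccurrences v Is xs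
occurrences-pairWord a v [] [] p = refl
occurrences-pairWord a v (I ∷ Is) (x ∷ xs) p with wide I in wI
occurrences-pairWord a v (I ∷ Is) (nothing ∷ xs) p | true  = occurrences-pairWord a v Is xs p
occurrences-pairWord a v (I ∷ Is) (nothing ∷ xs) p | false = occurrences-pairWord a v Is xs p
occurrences-pairWord a v (I ∷ Is) (just u ∷ xs) p | false rewrite selected-narrow a I (just u) wI | occurrences-pairWord a v Is xs p =
  x∙yz≈y∙xz (χ (u ≡ᵇ v)) (countRel _≡ᵇ_ v (pairWord a Is xs)) (narrowOccurrences v Is xs)
occurrences-pairWord a v (I ∷ Is) (just u ∷ xs) p | true rewrite selected-wide a I u wI with inPair a u in pu
... | true  rewrite occurrences-pairWord a v Is xs p = sym (+-assoc (χ (u ≡ᵇ v)) _ _)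
... | false rewrite ≢⇒≡ᵇ-false (λ u≡v → true≢false (trans (sym p) (subst (λ z → inPair a z ≡ false) u≡v pu))) =
  occurrences-pairWord a v Is xs p

narrowOccurrences-cong : ∀ v {n} (Is : Vec Interval n) ys xs → AgreeOnNarrow Is ys xs → narrowOccurrences v Is ys ≡ narrowOccurrences v Is xs
narrowOccurrences-cong v [] [] [] ag = refl
narrowOccurrences-cong v (I ∷ Is) (y ∷ ys) (x ∷ xs) ag with wide I in wI
... | true  = narrowOccurrences-cong v Is ys xs (ag ∘ suc)
... | false = cong₂ _+_ (cong (χ ∘ hasLetter v) (ag zero wI)) (narrowOccurrences-cong v Is ys xs (ag ∘ suc))

occurrences-split : ∀ v {n} (Is : Vec Interval n) rs → occurrences v rs ≡ wideOccurrences v Is rs + narrowOccurrences v Is rs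
occurrences-split v [] [] = refl
occurrences-split v (I ∷ Is) (r ∷ rs) rewrite occurrences-split v Is rs with wide I
... | true  = sym (+-assoc (χ (hasLetter v r)) (wideOccurrences v Is rs) (narrowOccurrences v Is rs))
... | false = x∙yz≈y∙xz (χ (hasLetter v r)) (wideOccurrences v Is rs) (narrowOccurrences v Is rs)

length-pairWord : ∀ a {n} (Is : Vec Interval n) xs → L.length (pairWord a Is xs) ≡ wideOccurrences a Is (mergeʷ a xs)
length-pairWord a [] [] = refl
length-pairWord a (I ∷ Is) (x ∷ xs) with wide I in wI
length-pairWord a (I ∷ Is) (nothing ∷ xs) | false = length-pairWord a Is xs
length-pairWord a (I ∷ Is) (just u ∷ xs)  | false rewrite selected-narrow a I (just u) wI = length-pairWord a Is xs
length-pairWord a (I ∷ Is) (nothing ∷ xs) | true = length-pairWord a Is xs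
length-pairWord a (I ∷ Is) (just u ∷ xs)  | true rewrite selected-wide a I u wI with inPair a u in pu
... | true  rewrite merge-inPair {a} {u} pu | ≡ᵇ-refl a = cong suc (length-pairWord a Is xs)
... | false rewrite ≢⇒≡ᵇ-false (λ e → true≢false (trans (sym (merge≡⇒inPair {a} {u} e)) pu)) = length-pairWord a Is xs

pairWord-inPair : ∀ a {n} (Is : Vec Interval n) xs → AllInPair a (pairWord a Is xs)
pairWord-inPair a [] [] = All.[]
pairWord-inPair a (I ∷ Is) (nothing ∷ xs) = pairWord-inPair a Is xs
pairWord-inPair a (I ∷ Is) (just u ∷ xs) with wide I ∧ inPair a u in e
... | true  = ∧-trueʳ {wide I} e All.∷ pairWord-inPair a Is xs
... | false = pairWord-inPair a Is xs

Nested : Interval → Interval → Set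
Nested (l₁ , h₁) (l₂ , h₂) = (l₁ ≤ l₂ × h₂ ≤ h₁) ⊎ (l₂ ≤ l₁ × h₁ ≤ h₂)

Chain : ∀ {n} → Vec Interval n → Set
Chain Is = ∀ i j → Nested (lookup Is i) (lookup Is j)

BoundedBy : ∀ {n} → ℕ → Vec Interval n → Set
BoundedBy f Is = ∀ i → wide (lookup Is i) ≡ true → suc (proj₂ (lookup Is i)) ≤ f

anyWide : ∀ {n} → Vec Interval n → Bool
anyWide []       = false
anyWide (I ∷ Is) = wide I ∨ anyWide Is

maxWideLow : ∀ {n} → Vec Interval n → ℕ
maxWideLow []       = 0
maxWideLow (I ∷ Is) = if wide I then proj₁ I ⊔ maxWideLow Is else maxWideLow Is

low≤maxWideLow : ∀ {n} (Is : Vec Interval n) i → wide (lookup Is i) ≡ true → proj₁ (lookup Is i) ≤ maxWideLow Is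
low≤maxWideLow (I ∷ Is) zero e rewrite e = m≤m⊔n (proj₁ I) (maxWideLow Is)
low≤maxWideLow (I ∷ Is) (suc i) e with wide I
... | true  = ≤-trans (low≤maxWideLow Is i e) (m≤n⊔m (proj₁ I) (maxWideLow Is))
... | false = low≤maxWideLow Is i e

maxWideLow≤ : ∀ {n} (Is : Vec Interval n) {b} → anyWide Is ≡ false → maxWideLow Is ≤ b
maxWideLow≤ []       _ = z≤n
maxWideLow≤ (I ∷ Is) e with wide I
... | false = maxWideLow≤ Is e

maxWideLow-attained : ∀ {n} (Is : Vec Interval n) → anyWide Is ≡ true →
                      Σ[ i ∈ Fin n ] (wide (lookup Is i) ≡ true × maxWideLow Is ≡ proj₁ (lookup Is i))
maxWideLow-attained (I ∷ Is) e with wide I in wI | anyWide Is in aw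
... | false | true with maxWideLow-attained Is aw
...   | i , p , q = suc i , p , q
maxWideLow-attained (I ∷ Is) e | true | false = zero , wI , m≥n⇒m⊔n≡m (maxWideLow≤ Is aw)
maxWideLow-attained (I ∷ Is) e | true | true with maxWideLow-attained Is aw
... | i , p , q with ≤-total (proj₁ I) (maxWideLow Is)
...   | inj₁ le = suc i , p , trans (m≤n⇒m⊔n≡n le) q
...   | inj₂ ge = zero , wI , m≥n⇒m⊔n≡m ge

-- Every wide interval starts at or before a = maxWideLow Is and, being nested with the wide
-- interval starting at a, ends after a.
straddle-maxWideLow : ∀ {n} (Is : Vec Interval n) → Chain Is → anyWide Is ≡ true → AllStraddle (maxWideLow Is) Is
straddle-maxWideLow Is ch aw i wi with maxWideLow-attained Is aw
... | j , wj , eq = low≤maxWideLow Is i wi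
                  , subst (λ z → suc z ≤ proj₂ (lookup Is i)) (sym eq) (nested (lookup Is i) (lookup Is j) wi wj (ch i j))
  where
    nested : ∀ I J → wide I ≡ true → wide J ≡ true → Nested I J → suc (proj₁ J) ≤ proj₂ I
    nested (l₁ , h₁) (l₂ , h₂) e₁ e₂ (inj₁ (p , q)) = ≤-trans (<ᵇ-true⇒< e₂) q
    nested (l₁ , h₁) (l₂ , h₂) e₁ e₂ (inj₂ (p , q)) = ≤-trans (s≤s p) (<ᵇ-true⇒< e₁)

chain-merge : ∀ a {n} (Is : Vec Interval n) → Chain Is → Chain (mergeᵛ a Is)
chain-merge a Is ch i j rewrite lookup-map i (mergeᵢ a) Is | lookup-map j (mergeᵢ a) Is = nested (lookup Is i) (lookup Is j) (ch i j)
  where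
    nested : ∀ I J → Nested I J → Nested (mergeᵢ a I) (mergeᵢ a J)
    nested (l₁ , h₁) (l₂ , h₂) (inj₁ (p , q)) = inj₁ (merge-mono-≤ a p , merge-mono-≤ a q)
    nested (l₁ , h₁) (l₂ , h₂) (inj₂ (p , q)) = inj₂ (merge-mono-≤ a p , merge-mono-≤ a q)

narrow-merge : ∀ a I → wide I ≡ false → wide (mergeᵢ a I) ≡ false
narrow-merge a (l , h) e = ≥⇒<ᵇ-false {merge a l} {merge a h} (merge-mono-≤ a (<ᵇ-false⇒≥ {l} {h} e))

wide-merge⁻ : ∀ a I → wide (mergeᵢ a I) ≡ true → wide I ≡ true
wide-merge⁻ a I e with wide I in wI
... | true  = refl
... | false = sym (trans (sym e) (narrow-merge a I wI))

bounded-merge : ∀ a f {n} (Is : Vec Interval n) → BoundedBy (suc f) Is → AllStraddle a Is → BoundedBy f (mergeᵛ a Is)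
bounded-merge a f Is bd st i e rewrite lookup-map i (mergeᵢ a) Is with lookup Is i | bd i | st i
... | (l , h) | bdᵢ | stᵢ with wide-merge⁻ a (l , h) e
...   | wᵢ rewrite merge-> {a} {h} (proj₂ (stᵢ wᵢ)) =
  subst (_≤ f) (sym (suc-pred h {{>-nonZero (≤-trans (s≤s z≤n) (proj₂ (stᵢ wᵢ)))}})) (≤-pred (bdᵢ wᵢ))

bounded-0⇒narrow : ∀ {n} (Is : Vec Interval n) → BoundedBy 0 Is → ∀ i → wide (lookup Is i) ≡ false
bounded-0⇒narrow Is bd i with wide (lookup Is i) in e
... | false = refl
... | true with bd i e
...   | ()

anyWide-false⇒narrow : ∀ {n} (Is : Vec Interval n) → anyWide Is ≡ false → ∀ i → wide (lookup Is i) ≡ false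
anyWide-false⇒narrow (I ∷ Is) e zero with wide I
... | false = refl
anyWide-false⇒narrow (I ∷ Is) e (suc i) with wide I
... | false = anyWide-false⇒narrow Is e i

fits-merge : ∀ a {n} (Is : Vec Interval n) xs → AllFit Is xs → AllFit (mergeᵛ a Is) (mergeʷ a xs)
fits-merge a Is xs o i rewrite lookup-map i (mergeᵢ a) Is | lookup-map i (mergeₘ a) xs with lookup Is i | lookup xs i | o i
... | I       | nothing | _ = tt
... | (l , h) | just u  | e with ∈ᵢ⁻ {u} {l} {h} e
...   | p , q = ∈ᵢ⁺ (merge-mono-≤ a p) (merge-mono-≤ a q)

crossings-narrow : ∀ {c} → (∀ u → c u u ≡ false) → ∀ {n} (Is : Vec Interval n) xs → (∀ i → wide (lookup Is i) ≡ false) →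
                   AllFit Is xs → crossings c Is xs ≡ 0
crossings-narrow irr [] [] d o = refl
crossings-narrow {c} irr (I ∷ Is) (x ∷ xs) d o = cong₂ _+_ (from Is xs) (crossings-narrow irr Is xs (d ∘ suc) (o ∘ suc))
  where
    from : ∀ {m} (Js : Vec Interval m) ys → crossingsFrom c I x Js ys ≡ 0
    from []       []       = refl
    from (J ∷ Js) (y ∷ ys) rewrite crossing-narrowˡ {c} irr I x J y (d zero) (o zero) = from Js ys

-- The involution on words

-- The fuel f bounds the rows of the wide intervals; every step merges two of them.
Φ : ℕ → ∀ {n} → Vec Interval n → Word n → Word n
Φ zero    Is xs = xs
Φ (suc f) Is xs =
  if anyWide Is
  then refill (maxWideLow Is) Is xs (Φ f (mergeᵛ (maxWideLow Is) Is) (mergeʷ (maxWideLow Is) xs)) (L.reverse (pairWord (maxWideLow Is) Is xs))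
  else xs

record ΦSpec (f : ℕ) {n : ℕ} (Is : Vec Interval n) (xs : Word n) : Set where
  field
    fits          : AllFit Is (Φ f Is xs)
    involutive    : Φ f Is (Φ f Is xs) ≡ xs
    support-Φ     : support (Φ f Is xs) ≡ support xs
    occurrences-Φ : ∀ v → occurrences v (Φ f Is xs) ≡ occurrences v xs
    narrow-Φ      : AgreeOnNarrow Is (Φ f Is xs) xs
    crossings-Φ   : crossings _<ᵇ_ Is (Φ f Is xs) ≡ crossings (flip _<ᵇ_) Is xs
open ΦSpec

ΦSpec-identity : ∀ f {n} (Is : Vec Interval n) xs → (∀ ys → Φ f Is ys ≡ ys) → (∀ i → wide (lookup Is i) ≡ false) →
                 AllFit Is xs → ΦSpec f Is xs
ΦSpec-identity f Is xs id narrow o = record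
  { fits          = subst (AllFit Is) (sym (id xs)) o
  ; involutive    = trans (id (Φ f Is xs)) (id xs)
  ; support-Φ     = cong support (id xs)
  ; occurrences-Φ = λ v → cong (occurrences v) (id xs)
  ; narrow-Φ      = λ i _ → cong (λ ys → lookup ys i) (id xs)
  ; crossings-Φ   = trans (cong (crossings _<ᵇ_ Is) (id xs))
                          (trans (crossings-narrow {_<ᵇ_} <ᵇ-irrefl Is xs narrow o) (sym (crossings-narrow {flip _<ᵇ_} <ᵇ-irrefl Is xs narrow o)))
  }

module ΦStep (f : ℕ) {n : ℕ} (Is : Vec Interval n) (xs : Word n) (aw : anyWide Is ≡ true) (ch : Chain Is) (o : AllFit Is xs)
             (IH : ΦSpec f (mergeᵛ (maxWideLow Is) Is) (mergeʷ (maxWideLow Is) xs)) where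
  open ≡-Reasoning

  a : ℕ
  a = maxWideLow Is

  straddles : AllStraddle a Is
  straddles = straddle-maxWideLow Is ch aw

  ws : List ℕ
  ws = pairWord a Is xs

  r : Word n
  r = Φ f (mergeᵛ a Is) (mergeʷ a xs)

  Φ-suc : ∀ ys → Φ (suc f) Is ys ≡ refill a Is ys (Φ f (mergeᵛ a Is) (mergeʷ a ys)) (L.reverse (pairWord a Is ys))
  Φ-suc ys rewrite aw = refl

  r-agrees : AgreeOnNarrow Is r (mergeʷ a xs)
  r-agrees i d = narrow-Φ IH i (subst (λ I → wide I ≡ false) (sym (lookup-map i (mergeᵢ a) Is)) (narrow-merge a (lookup Is i) d))

  reverse-inPair : AllInPair a (L.reverse ws)
  reverse-inPair = ↭.All-resp-↭ (↭-sym (↭.↭-reverse ws)) (pairWord-inPair a Is xs)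

  wideOccurrences-r : wideOccurrences a Is r ≡ wideOccurrences a Is (mergeʷ a xs)
  wideOccurrences-r = +-cancelʳ-≡ (narrowOccurrences a Is (mergeʷ a xs)) _ _ (begin
    wideOccurrences a Is r + narrowOccurrences a Is (mergeʷ a xs) ≡⟨ cong (wideOccurrences a Is r +_) (narrowOccurrences-cong a Is r _ r-agrees) ⟨
    wideOccurrences a Is r + narrowOccurrences a Is r             ≡⟨ occurrences-split a Is r ⟨
    occurrences a r                                               ≡⟨ occurrences-Φ IH a ⟩
    occurrences a (mergeʷ a xs)                                   ≡⟨ occurrences-split a Is (mergeʷ a xs) ⟩
    wideOccurrences a Is (mergeʷ a xs) + narrowOccurrences a Is (mergeʷ a xs) ∎)

  length-reverse-ws : L.length (L.reverse ws) ≡ wideOccurrences a Is r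
  length-reverse-ws = trans (length-reverse ws) (trans (length-pairWord a Is xs) (sym wideOccurrences-r))

  merge-Φ-suc : mergeʷ a (Φ (suc f) Is xs) ≡ r
  merge-Φ-suc rewrite Φ-suc xs = mergeʷ-refill a Is xs r (L.reverse ws) r-agrees reverse-inPair

  pairWord-Φ-suc : pairWord a Is (Φ (suc f) Is xs) ≡ L.reverse ws
  pairWord-Φ-suc rewrite Φ-suc xs = pairWord-refill a Is xs r (L.reverse ws) length-reverse-ws reverse-inPair

  narrow-suc : AgreeOnNarrow Is (Φ (suc f) Is xs) xs
  narrow-suc rewrite Φ-suc xs = refill-agrees a Is xs r (L.reverse ws)

  fits-suc : AllFit Is (Φ (suc f) Is xs)
  fits-suc rewrite Φ-suc xs = refill-fits a Is xs r (L.reverse ws) o (fits IH) reverse-inPair straddles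

  support-suc : support (Φ (suc f) Is xs) ≡ support xs
  support-suc = begin
    support (Φ (suc f) Is xs)            ≡⟨ support-merge a (Φ (suc f) Is xs) ⟨
    support (mergeʷ a (Φ (suc f) Is xs)) ≡⟨ cong support merge-Φ-suc ⟩
    support r                            ≡⟨ support-Φ IH ⟩
    support (mergeʷ a xs)                ≡⟨ support-merge a xs ⟩
    support xs                           ∎

  occurrences-suc : ∀ v → occurrences v (Φ (suc f) Is xs) ≡ occurrences v xs
  occurrences-suc v with true-or-false (inPair a v)
  ... | inj₂ outside = begin
    occurrences v (Φ (suc f) Is xs)                      ≡⟨ occurrences-merge a v (Φ (suc f) Is xs) outside ⟩
    occurrences (merge a v) (mergeʷ a (Φ (suc f) Is xs)) ≡⟨ cong (occurrences (merge a v)) merge-Φ-suc ⟩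
    occurrences (merge a v) r                            ≡⟨ occurrences-Φ IH (merge a v) ⟩
    occurrences (merge a v) (mergeʷ a xs)                ≡⟨ occurrences-merge a v xs outside ⟨
    occurrences v xs                                     ∎
  ... | inj₁ inside = begin
    occurrences v (Φ (suc f) Is xs)
      ≡⟨ occurrences-pairWord a v Is (Φ (suc f) Is xs) inside ⟩
    countRel _≡ᵇ_ v (pairWord a Is (Φ (suc f) Is xs)) + narrowOccurrences v Is (Φ (suc f) Is xs)
      ≡⟨ cong₂ _+_ (cong (countRel _≡ᵇ_ v) pairWord-Φ-suc) (narrowOccurrences-cong v Is _ xs narrow-suc) ⟩
    countRel _≡ᵇ_ v (L.reverse ws) + narrowOccurrences v Is xs
      ≡⟨ cong (_+ narrowOccurrences v Is xs) (countRel-reverse _≡ᵇ_ v ws) ⟩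
    countRel _≡ᵇ_ v ws + narrowOccurrences v Is xs
      ≡⟨ occurrences-pairWord a v Is xs inside ⟨
    occurrences v xs ∎

  involutive-suc : Φ (suc f) Is (Φ (suc f) Is xs) ≡ xs
  involutive-suc = begin
    Φ (suc f) Is (Φ (suc f) Is xs)
      ≡⟨ Φ-suc (Φ (suc f) Is xs) ⟩
    refill a Is (Φ (suc f) Is xs) (Φ f (mergeᵛ a Is) (mergeʷ a (Φ (suc f) Is xs))) (L.reverse (pairWord a Is (Φ (suc f) Is xs)))
      ≡⟨ cong₂ (refill a Is (Φ (suc f) Is xs)) (cong (Φ f (mergeᵛ a Is)) merge-Φ-suc) (cong L.reverse pairWord-Φ-suc) ⟩
    refill a Is (Φ (suc f) Is xs) (Φ f (mergeᵛ a Is) r) (L.reverse (L.reverse ws))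
      ≡⟨ cong₂ (refill a Is (Φ (suc f) Is xs)) (involutive IH) (reverse-involutive ws) ⟩
    refill a Is (Φ (suc f) Is xs) (mergeʷ a xs) ws
      ≡⟨ refill-cong a Is _ xs (mergeʷ a xs) ws narrow-suc ⟩
    refill a Is xs (mergeʷ a xs) ws
      ≡⟨ refill-merge a Is xs ⟩
    xs ∎

  crossings-suc : crossings _<ᵇ_ Is (Φ (suc f) Is xs) ≡ crossings (flip _<ᵇ_) Is xs
  crossings-suc = begin
    crossings _<ᵇ_ Is (Φ (suc f) Is xs)
      ≡⟨ crossings-merge <ᵇ-mergeInvariant a Is _ fits-suc straddles ⟩
    crossings _<ᵇ_ (mergeᵛ a Is) (mergeʷ a (Φ (suc f) Is xs)) + inversions _<ᵇ_ (pairWord a Is (Φ (suc f) Is xs))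
      ≡⟨ cong₂ _+_ (cong (crossings _<ᵇ_ (mergeᵛ a Is)) merge-Φ-suc) (cong (inversions _<ᵇ_) pairWord-Φ-suc) ⟩
    crossings _<ᵇ_ (mergeᵛ a Is) r + inversions _<ᵇ_ (L.reverse ws)
      ≡⟨ cong₂ _+_ (crossings-Φ IH) (inversions-reverse _<ᵇ_ ws) ⟩
    crossings (flip _<ᵇ_) (mergeᵛ a Is) (mergeʷ a xs) + inversions (flip _<ᵇ_) ws
      ≡⟨ crossings-merge >ᵇ-mergeInvariant a Is xs o straddles ⟨
    crossings (flip _<ᵇ_) Is xs ∎

  spec : ΦSpec (suc f) Is xs
  spec = record
    { fits = fits-suc ; involutive = involutive-suc ; support-Φ = support-suc ; occurrences-Φ = occurrences-suc ; narrow-Φ = narrow-suc ; crossings-Φ = crossings-suc }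

Φ-spec : ∀ f {n} (Is : Vec Interval n) xs → Chain Is → BoundedBy f Is → AllFit Is xs → ΦSpec f Is xs
Φ-spec zero Is xs ch bd o = ΦSpec-identity zero Is xs (λ _ → refl) (bounded-0⇒narrow Is bd) o
Φ-spec (suc f) Is xs ch bd o with anyWide Is in aw
... | false = ΦSpec-identity (suc f) Is xs (λ ys → Φ-narrow ys) (anyWide-false⇒narrow Is aw) o
  where
    Φ-narrow : ∀ ys → Φ (suc f) Is ys ≡ ys
    Φ-narrow ys rewrite aw = refl
... | true = ΦStep.spec f Is xs aw ch o
  (Φ-spec f (mergeᵛ a Is) (mergeʷ a xs) (chain-merge a Is ch) (bounded-merge a f Is bd (straddle-maxWideLow Is ch aw)) (fits-merge a Is xs o))
  where
    a : ℕ
    a = maxWideLow Is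

-- Finite sums and exhaustive counting

Complete : ∀ {A : Set} → List A → Set
Complete {A} xs = ∀ (x : A) → x ∈ xs

sum-map-cong : ∀ {A : Set} (xs : List A) {f g : A → ℕ} → (∀ x → f x ≡ g x) → sum (L.map f xs) ≡ sum (L.map g xs)
sum-map-cong xs e = cong sum (map-cong e xs)

countᵇ-cong : ∀ {A : Set} {p q : A → Bool} (xs : List A) → (∀ x → p x ≡ q x) → countᵇ p xs ≡ countᵇ q xs
countᵇ-cong xs e = sum-map-cong xs (λ x → cong (λ b → if b then 1 else 0) (e x))

countᵇ-bijection : {A B : Set} (xs : List A) (ys : List B) → Complete xs → Unique xs → Complete ys → Unique ys →
  (f : A → B) (g : B → A) → (∀ x → g (f x) ≡ x) → (∀ y → f (g y) ≡ y) →
  (p : B → Bool) → countᵇ p ys ≡ countᵇ (p ∘ f) xs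
countᵇ-bijection {A} {B} xs ys cx ux cy uy f g gf fg p = begin
    sum (L.map h ys)           ≡⟨ sum-↭ (↭.map⁺ h (↭-sym map-f-xs↭ys)) ⟩
    sum (L.map h (L.map f xs)) ≡⟨ cong sum (map-∘ xs) ⟨
    sum (L.map (h ∘ f) xs)     ∎
  where
    open ≡-Reasoning
    h : B → ℕ
    h y = if p y then 1 else 0
    f-injective : ∀ {x x′} → f x ≡ f x′ → x ≡ x′
    f-injective {x} {x′} e = trans (sym (gf x)) (trans (cong g e) (gf x′))
    map-f-xs↭ys : L.map f xs ↭ ys
    map-f-xs↭ys = ∼bag⇒↭ (unique∧set⇒bag (Unique.map⁺ f-injective ux) uy
                    (λ {y} → mk⇔ (λ _ → cy y) (λ _ → subst (_∈ L.map f xs) (fg y) (∈-map⁺ f (cx (g y))))))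

allVecs-cartesian : ∀ {A : Set} n (xs : List A) → allVecs (suc n) xs ≡ cartesianProductWith _∷_ xs (allVecs n xs)
allVecs-cartesian n xs = go xs
  where
    go : ∀ ys → concatMap (λ x → L.map (x ∷_) (allVecs n xs)) ys ≡ cartesianProductWith _∷_ ys (allVecs n xs)
    go []       = refl
    go (y ∷ ys) = cong (L.map (y ∷_) (allVecs n xs) ++_) (go ys)

allVecs-complete : ∀ {A : Set} n (xs : List A) → Complete xs → Complete (allVecs n xs)
allVecs-complete zero    xs c []      = here refl
allVecs-complete (suc n) xs c (y ∷ v) rewrite allVecs-cartesian n xs =
  ∈-cartesianProductWith⁺ _∷_ (c y) (allVecs-complete n xs c v)

allVecs-unique : ∀ {A : Set} n (xs : List A) → Unique xs → Unique (allVecs n xs)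
allVecs-unique zero    xs u = All.[] ∷ []
allVecs-unique (suc n) xs u rewrite allVecs-cartesian n xs =
  Unique.cartesianProductWith⁺ _∷_ (λ e → ∷-injectiveˡ e , ∷-injectiveʳ e) u (allVecs-unique n xs u)

allArrays-complete : ∀ s t → Complete (allArrays s t)
allArrays-complete s t = allVecs-complete s _ (allVecs-complete t _ λ { true → here refl ; false → there (here refl) })

allArrays-unique : ∀ s t → Unique (allArrays s t)
allArrays-unique s t = allVecs-unique s _ (allVecs-unique t _ (((λ ()) All.∷ All.[]) ∷ All.[] ∷ []))

sum-map-tabulate : ∀ {A : Set} n (g : Fin n → A) (h : A → ℕ) → sum (L.map h (L.tabulate g)) ≡ ∑ (h ∘ g)
sum-map-tabulate zero    g h = refl
sum-map-tabulate (suc n) g h = cong (h (g zero) +_) (sum-map-tabulate n (g ∘ suc) h)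

countᵇ-allFin : ∀ n (p : Fin n → Bool) → countᵇ p (allFin n) ≡ ∑ (χ ∘ p)
countᵇ-allFin n p = trans (sum-map-tabulate n (λ i → i) (λ i → if p i then 1 else 0)) (sum-cong-≗ (if-χ ∘ p))

sum-map-concatMap : ∀ {A B : Set} (xs : List A) (f : A → List B) (h : B → ℕ) →
                    sum (L.map h (concatMap f xs)) ≡ sum (L.map (λ x → sum (L.map h (f x))) xs)
sum-map-concatMap []       f h = refl
sum-map-concatMap (x ∷ xs) f h = begin
    sum (L.map h (f x ++ concatMap f xs))                ≡⟨ cong sum (map-++ h (f x) (concatMap f xs)) ⟩
    sum (L.map h (f x) ++ L.map h (concatMap f xs))       ≡⟨ sum-++ (L.map h (f x)) (L.map h (concatMap f xs)) ⟩
    sum (L.map h (f x)) + sum (L.map h (concatMap f xs)) ≡⟨ cong (sum (L.map h (f x)) +_) (sum-map-concatMap xs f h) ⟩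
    sum (L.map h (f x)) + sum (L.map (λ x → sum (L.map h (f x))) xs) ∎
  where open ≡-Reasoning

sum-cells : ∀ s t (h : Cell s t → ℕ) → sum (L.map h (cells s t)) ≡ ∑ λ i → ∑ λ j → h (i , j)
sum-cells s t h = trans (sum-map-concatMap (allFin s) (λ i → L.map (i ,_) (allFin t)) h)
                 (trans (sum-map-cong (allFin s) (λ i → trans (cong sum (sym (map-∘ (allFin t)))) (sum-map-tabulate t (λ j → j) (λ j → h (i , j)))))
                        (sum-map-tabulate s (λ i → i) (λ i → ∑ λ j → h (i , j))))

countᵇ-cellPairs : ∀ s t (p : Cell s t × Cell s t → Bool) →
  countᵇ p (cellPairs s t) ≡ ∑ λ i → ∑ λ j → ∑ λ i′ → ∑ λ j′ → χ (p ((i , j) , (i′ , j′)))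
countᵇ-cellPairs s t p = begin
    sum (L.map h (cellPairs s t))
      ≡⟨ sum-map-concatMap (cells s t) (λ x → L.map (x ,_) (cells s t)) h ⟩
    sum (L.map (λ x → sum (L.map h (L.map (x ,_) (cells s t)))) (cells s t))
      ≡⟨ sum-map-cong (cells s t) (λ x → trans (cong sum (sym (map-∘ (cells s t)))) (sum-cells s t (λ y → h (x , y)))) ⟩
    sum (L.map (λ x → ∑ λ i′ → ∑ λ j′ → h (x , (i′ , j′))) (cells s t))
      ≡⟨ sum-cells s t _ ⟩
    (∑ λ i → ∑ λ j → ∑ λ i′ → ∑ λ j′ → h ((i , j) , (i′ , j′)))
      ≡⟨ sum-cong-≗ (λ i → sum-cong-≗ (λ j → sum-cong-≗ (λ i′ → sum-cong-≗ (λ j′ → if-χ (p ((i , j) , (i′ , j′))))))) ⟩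
    (∑ λ i → ∑ λ j → ∑ λ i′ → ∑ λ j′ → χ (p ((i , j) , (i′ , j′)))) ∎
  where
    open ≡-Reasoning
    h : Cell s t × Cell s t → ℕ
    h x = if p x then 1 else 0

and-map-tabulate⁻ : ∀ {A : Set} n (g : Fin n → A) (p : A → Bool) → and (L.map p (L.tabulate g)) ≡ true → ∀ i → p (g i) ≡ true
and-map-tabulate⁻ (suc n) g p e zero    = ∧-trueˡ e
and-map-tabulate⁻ (suc n) g p e (suc i) = and-map-tabulate⁻ n (g ∘ suc) p (∧-trueʳ {p (g zero)} e) i

and-map-tabulate⁺ : ∀ {A : Set} n (g : Fin n → A) (p : A → Bool) → (∀ i → p (g i) ≡ true) → and (L.map p (L.tabulate g)) ≡ true
and-map-tabulate⁺ zero    g p h = refl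
and-map-tabulate⁺ (suc n) g p h = ∧-true (h zero) (and-map-tabulate⁺ n (g ∘ suc) p (h ∘ suc))

allRows-true⁻ : ∀ n p → allRows n p ≡ true → ∀ i → p i ≡ true
allRows-true⁻ n p = and-map-tabulate⁻ n (λ i → i) p

allRows-true : ∀ n p → (∀ i → p i ≡ true) → allRows n p ≡ true
allRows-true n p = and-map-tabulate⁺ n (λ i → i) p

allRows-cong : ∀ n {p q : Fin n → Bool} → (∀ i → p i ≡ q i) → allRows n p ≡ allRows n q
allRows-cong n {p} {q} e = bool-ext (λ h → allRows-true n q (λ i → trans (sym (e i)) (allRows-true⁻ n p h i)))
                                    (λ h → allRows-true n p (λ i → trans (e i) (allRows-true⁻ n q h i)))

-- Fillings of a moon polyomino as words

anyTrue : ∀ n → (Fin n → Bool) → Bool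
anyTrue zero    f = false
anyTrue (suc n) f = f zero ∨ anyTrue n (f ∘ suc)

-- Positions of the first and of the last true entry (0 when there is none).
firstTrue : ∀ n → (Fin n → Bool) → ℕ
firstTrue zero    f = 0
firstTrue (suc n) f = if f zero then 0 else suc (firstTrue n (f ∘ suc))

lastTrue : ∀ n → (Fin n → Bool) → ℕ
lastTrue zero    f = 0
lastTrue (suc n) f = if anyTrue n (f ∘ suc) then suc (lastTrue n (f ∘ suc)) else 0

firstTrue-≤ : ∀ n (f : Fin n → Bool) i → f i ≡ true → firstTrue n f ≤ toℕ i
firstTrue-≤ (suc n) f i e with f zero in e₀
... | true = z≤n
firstTrue-≤ (suc n) f zero    e | false = ⊥-elim (true≢false (trans (sym e) e₀))
firstTrue-≤ (suc n) f (suc i) e | false = s≤s (firstTrue-≤ n (f ∘ suc) i e)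

firstTrue-attained : ∀ n (f : Fin n → Bool) i → f i ≡ true → Σ[ i₀ ∈ Fin n ] (toℕ i₀ ≡ firstTrue n f × f i₀ ≡ true)
firstTrue-attained (suc n) f i e with f zero in e₀
... | true = zero , refl , e₀
firstTrue-attained (suc n) f zero    e | false = ⊥-elim (true≢false (trans (sym e) e₀))
firstTrue-attained (suc n) f (suc i) e | false with firstTrue-attained n (f ∘ suc) i e
... | i₀ , p , q = suc i₀ , cong suc p , q

anyTrue-true : ∀ n (f : Fin n → Bool) i → f i ≡ true → anyTrue n f ≡ true
anyTrue-true (suc n) f zero    e rewrite e = refl
anyTrue-true (suc n) f (suc i) e rewrite anyTrue-true n (f ∘ suc) i e = ∨-zeroʳ (f zero)

anyTrue-false : ∀ n (f : Fin n → Bool) → anyTrue n f ≡ false → ∀ i → f i ≡ false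
anyTrue-false (suc n) f e zero with f zero
... | false = refl
anyTrue-false (suc n) f e (suc i) with f zero
... | false = anyTrue-false n (f ∘ suc) e i

anyTrue-witness : ∀ n (f : Fin n → Bool) → anyTrue n f ≡ true → Σ[ k ∈ Fin n ] f k ≡ true
anyTrue-witness (suc n) f e with f zero in e₀
... | true = zero , e₀
... | false with anyTrue-witness n (f ∘ suc) e
...   | k , p = suc k , p

≤-lastTrue : ∀ n (f : Fin n → Bool) i → f i ≡ true → toℕ i ≤ lastTrue n f
≤-lastTrue (suc n) f zero    e = z≤n
≤-lastTrue (suc n) f (suc i) e rewrite anyTrue-true n (f ∘ suc) i e = s≤s (≤-lastTrue n (f ∘ suc) i e)

lastTrue-attained : ∀ n (f : Fin n → Bool) i → f i ≡ true → Σ[ i₁ ∈ Fin n ] (toℕ i₁ ≡ lastTrue n f × f i₁ ≡ true)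
lastTrue-attained (suc n) f i e with anyTrue n (f ∘ suc) in ea
lastTrue-attained (suc n) f zero    e | false = zero , refl , e
lastTrue-attained (suc n) f (suc i) e | false = ⊥-elim (true≢false (trans (sym e) (anyTrue-false n (f ∘ suc) ea i)))
lastTrue-attained (suc n) f i e | true with anyTrue-witness n (f ∘ suc) ea
... | k , p with lastTrue-attained n (f ∘ suc) k p
...   | i₁ , q , r = suc i₁ , cong suc q , r

lastTrue< : ∀ n (f : Fin n → Bool) k → f k ≡ true → lastTrue n f < n
lastTrue< n f k e with lastTrue-attained n f k e
... | i₁ , p , _ = subst (_< n) p (toℕ<n i₁)

Convex : ∀ n → (Fin n → Bool) → Set
Convex n f = ∀ {i₁ i₂ i : Fin n} → f i₁ ≡ true → f i₂ ≡ true → toℕ i₁ ≤ toℕ i → toℕ i ≤ toℕ i₂ → f i ≡ true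

convex⇒interval : ∀ n (f : Fin n → Bool) → Convex n f → (∃[ k ] f k ≡ true) →
                  ∀ i → f i ≡ toℕ i ∈ᵢ (firstTrue n f , lastTrue n f)
convex⇒interval n f convex (k , e) i = bool-ext (λ fi → ∈ᵢ⁺ (firstTrue-≤ n f i fi) (≤-lastTrue n f i fi)) reflect
  where
    reflect : toℕ i ∈ᵢ (firstTrue n f , lastTrue n f) ≡ true → f i ≡ true
    reflect e′ with ∈ᵢ⁻ {toℕ i} {firstTrue n f} {lastTrue n f} e′ | firstTrue-attained n f k e | lastTrue-attained n f k e
    ... | p , q | i₀ , a₀ , b₀ | i₁ , a₁ , b₁ = convex b₀ b₁ (subst (_≤ toℕ i) (sym a₀) p) (subst (toℕ i ≤_) (sym a₁) q)

module ColumnIntervals {s t : ℕ} (T : Shape s t) (M : IsMoonPolyomino T) where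
  open IsMoonPolyomino M

  column : Fin t → Fin s → Bool
  column j i = T i j

  low high : Fin t → ℕ
  low j  = firstTrue s (column j)
  high j = lastTrue s (column j)

  columns : Vec Interval t
  columns = V.tabulate (λ j → (low j , high j))

  lookup-columns : ∀ j → lookup columns j ≡ (low j , high j)
  lookup-columns j = lookup∘tabulate (λ j → (low j , high j)) j

  T≡∈columns : ∀ i j → T i j ≡ toℕ i ∈ᵢ lookup columns j
  T≡∈columns i j rewrite lookup-columns j = convex⇒interval s (column j) (λ {i₁} {i₂} {i} → colConvex j {i₁} {i₂} {i}) (colNonempty j) i

  low-mono : ∀ {j₁ j₂} → (∀ i → T i j₁ ≡ true → T i j₂ ≡ true) → low j₂ ≤ low j₁
  low-mono {j₁} {j₂} sub with colNonempty j₁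
  ... | k , e with firstTrue-attained s (column j₁) k e
  ...   | i₀ , p , q = subst (low j₂ ≤_) p (firstTrue-≤ s (column j₂) i₀ (sub i₀ q))

  high-mono : ∀ {j₁ j₂} → (∀ i → T i j₁ ≡ true → T i j₂ ≡ true) → high j₁ ≤ high j₂
  high-mono {j₁} {j₂} sub with colNonempty j₁
  ... | k , e with lastTrue-attained s (column j₁) k e
  ...   | i₁ , p , q = subst (_≤ high j₂) p (≤-lastTrue s (column j₂) i₁ (sub i₁ q))

  columns-chain : Chain columns
  columns-chain j₁ j₂ rewrite lookup-columns j₁ | lookup-columns j₂ with colsNested j₁ j₂
  ... | inj₁ sub = inj₂ (low-mono sub , high-mono sub)
  ... | inj₂ sub = inj₁ (low-mono sub , high-mono sub)

  high<s : ∀ j → proj₂ (lookup columns j) < s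
  high<s j rewrite lookup-columns j with colNonempty j
  ... | k , e = lastTrue< s (column j) k e

  columns-bounded : BoundedBy s columns
  columns-bounded j _ = high<s j

firstIndex : ∀ n → (Fin n → Bool) → Maybe ℕ
firstIndex zero    f = nothing
firstIndex (suc n) f = if f zero then just 0 else M.map suc (firstIndex n (f ∘ suc))

Below : ℕ → Maybe ℕ → Set
Below n nothing  = ⊤
Below n (just u) = u < n

firstIndex-cong : ∀ n {f g : Fin n → Bool} → (∀ i → f i ≡ g i) → firstIndex n f ≡ firstIndex n g
firstIndex-cong zero    e = refl
firstIndex-cong (suc n) e rewrite e zero | firstIndex-cong n (e ∘ suc) = refl

firstIndex-hasLetter : ∀ n m → Below n m → firstIndex n (λ i → hasLetter (toℕ i) m) ≡ m
firstIndex-hasLetter zero    nothing        _       = refl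
firstIndex-hasLetter (suc n) nothing        _       = cong (M.map suc) (firstIndex-hasLetter n nothing tt)
firstIndex-hasLetter (suc n) (just zero)    _       = refl
firstIndex-hasLetter (suc n) (just (suc u)) (s≤s p) = cong (M.map suc) (firstIndex-hasLetter n (just u) p)

firstIndex-below : ∀ n f → Below n (firstIndex n f)
firstIndex-below zero    f = tt
firstIndex-below (suc n) f with f zero | firstIndex n (f ∘ suc) | firstIndex-below n (f ∘ suc)
... | true  | _       | _ = s≤s z≤n
... | false | nothing | _ = tt
... | false | just u  | p = s≤s p

∑-hasLetter : ∀ n m → Below n m → (∑ λ (i : Fin n) → χ (hasLetter (toℕ i) m)) ≡ χ (is-just m)
∑-hasLetter zero    nothing        _       = refl
∑-hasLetter (suc n) nothing        _       = ∑-hasLetter n nothing tt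
∑-hasLetter (suc n) (just zero)    _       = cong suc (sum-replicate-zero n)
∑-hasLetter (suc n) (just (suc u)) (s≤s p) = ∑-hasLetter n (just u) p

∑≤0⇒false : ∀ n (f : Fin n → Bool) → (∑ (χ ∘ f)) ≤ 0 → ∀ i → f i ≡ false
∑≤0⇒false (suc n) f le zero    with f zero
... | false = refl
∑≤0⇒false (suc n) f le (suc i) with f zero
... | false = ∑≤0⇒false n (f ∘ suc) le i

atMostOne⇒firstIndex : ∀ n (f : Fin n → Bool) → (∑ (χ ∘ f)) ≤ 1 → ∀ i → f i ≡ hasLetter (toℕ i) (firstIndex n f)
atMostOne⇒firstIndex (suc n) f le i with f zero in e₀
atMostOne⇒firstIndex (suc n) f le zero    | true = e₀
atMostOne⇒firstIndex (suc n) f le (suc i) | true = ∑≤0⇒false n (f ∘ suc) (≤-pred le) i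
atMostOne⇒firstIndex (suc n) f le zero    | false with firstIndex n (f ∘ suc)
... | nothing = e₀
... | just v  = e₀
atMostOne⇒firstIndex (suc n) f le (suc i) | false with atMostOne⇒firstIndex n (f ∘ suc) le i
... | r with firstIndex n (f ∘ suc)
...   | nothing = r
...   | just v  = r

array-ext : ∀ {s t} (F G : Array s t) → (∀ i j → entry F i j ≡ entry G i j) → F ≡ G
array-ext F G e = trans (sym (tabulate∘lookup F))
  (trans (tabulate-cong (λ i → trans (sym (tabulate∘lookup (lookup F i))) (trans (tabulate-cong (e i)) (tabulate∘lookup (lookup G i)))))
         (tabulate∘lookup G))

rowCount≡∑ : ∀ {s t} (F : Array s t) i → rowCount F i ≡ ∑ λ j → χ (entry F i j)
rowCount≡∑ {s} {t} F i = countᵇ-allFin t (entry F i)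

colCount≡∑ : ∀ {s t} (F : Array s t) j → colCount F j ≡ ∑ λ i → χ (entry F i j)
colCount≡∑ {s} {t} F j = countᵇ-allFin s (λ i → entry F i j)

module Encoding {s t : ℕ} where

  toWord : Array s t → Word t
  toWord F = V.tabulate (λ j → firstIndex s (λ i → entry F i j))

  fromWord : Word t → Array s t
  fromWord w = V.tabulate (λ i → V.tabulate (λ j → hasLetter (toℕ i) (lookup w j)))

  entry-fromWord : ∀ w i j → entry (fromWord w) i j ≡ hasLetter (toℕ i) (lookup w j)
  entry-fromWord w i j rewrite lookup∘tabulate (λ i → V.tabulate (λ j → hasLetter (toℕ i) (lookup w j))) i
    = lookup∘tabulate (λ j → hasLetter (toℕ i) (lookup w j)) j

  lookup-toWord : ∀ F j → lookup (toWord F) j ≡ firstIndex s (λ i → entry F i j)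
  lookup-toWord F j = lookup∘tabulate (λ j → firstIndex s (λ i → entry F i j)) j

  toWord-below : ∀ F j → Below s (lookup (toWord F) j)
  toWord-below F j rewrite lookup-toWord F j = firstIndex-below s (λ i → entry F i j)

  entry-toWord : ∀ (F : Array s t) j → colCount F j ≤ 1 → ∀ i → entry F i j ≡ hasLetter (toℕ i) (lookup (toWord F) j)
  entry-toWord F j le i rewrite lookup-toWord F j = atMostOne⇒firstIndex s (λ i → entry F i j) (subst (_≤ 1) (colCount≡∑ F j) le) i

  fromWord-toWord : ∀ (F : Array s t) → (∀ j → colCount F j ≤ 1) → fromWord (toWord F) ≡ F
  fromWord-toWord F le = array-ext (fromWord (toWord F)) F (λ i j → trans (entry-fromWord (toWord F) i j) (sym (entry-toWord F j (le j) i)))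

  toWord-fromWord : ∀ w → (∀ j → Below s (lookup w j)) → toWord (fromWord w) ≡ w
  toWord-fromWord w below = trans (sym (tabulate∘lookup (toWord (fromWord w))))
    (trans (tabulate-cong (λ j → trans (lookup-toWord (fromWord w) j)
                                  (trans (firstIndex-cong s (λ i → entry-fromWord w i j)) (firstIndex-hasLetter s (lookup w j) (below j)))))
           (tabulate∘lookup w))

  rowCount-fromWord : ∀ w i → rowCount (fromWord w) i ≡ occurrences (toℕ i) w
  rowCount-fromWord w i = trans (rowCount≡∑ (fromWord w) i) (trans (sum-cong-≗ (λ j → cong χ (entry-fromWord w i j))) (∑-occurrences w))
    where
      ∑-occurrences : ∀ {n} (w : Word n) → (∑ λ j → χ (hasLetter (toℕ i) (lookup w j))) ≡ occurrences (toℕ i) w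
      ∑-occurrences []      = refl
      ∑-occurrences (x ∷ w) = cong (χ (hasLetter (toℕ i) x) +_) (∑-occurrences w)

  colCount-fromWord : ∀ w j → Below s (lookup w j) → colCount (fromWord w) j ≡ χ (is-just (lookup w j))
  colCount-fromWord w j below =
    trans (colCount≡∑ (fromWord w) j) (trans (sum-cong-≗ (λ i → cong χ (entry-fromWord w i j))) (∑-hasLetter s (lookup w j) below))

hasLetter-true⁻ : ∀ {v} m → hasLetter v m ≡ true → m ≡ just v
hasLetter-true⁻ (just u) e = cong just (≡ᵇ-true⇒≡ e)

module MoonWords {s t : ℕ} (T : Shape s t) (M : IsMoonPolyomino T) where
  open IsMoonPolyomino M
  open ColumnIntervals T M
  open Encoding {s} {t}

  fits⇒below : ∀ w → AllFit columns w → ∀ j → Below s (lookup w j)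
  fits⇒below w o j with lookup w j | o j
  ... | nothing | _ = tt
  ... | just u  | e = ≤-<-trans (proj₂ (∈ᵢ⁻ {u} {proj₁ (lookup columns j)} {proj₂ (lookup columns j)} e)) (high<s j)

  fits⇒T : ∀ w i j → AllFit columns w → lookup w j ≡ just (toℕ i) → T i j ≡ true
  fits⇒T w i j o e with o j
  ... | oⱼ rewrite e = trans (T≡∈columns i j) oⱼ

  isFilling-fromWord : ∀ w → AllFit columns w → isFilling T (fromWord w) ≡ true
  isFilling-fromWord w o = allRows-true s _ (λ i → allRows-true t _ (λ j → cell i j))
    where
      cell : ∀ i j → (not (entry (fromWord w) i j) ∨ T i j) ≡ true
      cell i j rewrite entry-fromWord w i j with hasLetter (toℕ i) (lookup w j) in e
      ... | false = refl
      ... | true  rewrite fits⇒T w i j o (hasLetter-true⁻ (lookup w j) e) = refl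

  toWord-fits : ∀ F → (∀ j → colCount F j ≤ 1) → isFilling T F ≡ true → AllFit columns (toWord F)
  toWord-fits F le filling j with lookup (toWord F) j in e | toWord-below F j
  ... | nothing | _ = tt
  ... | just u  | u<s = subst (λ z → z ∈ᵢ lookup columns j ≡ true) (toℕ-fromℕ< u<s) (trans (sym (T≡∈columns i j)) Tᵢⱼ)
    where
      i : Fin s
      i = fromℕ< u<s
      Fᵢⱼ : entry F i j ≡ true
      Fᵢⱼ = trans (entry-toWord F j (le j) i)
                 (trans (cong (hasLetter (toℕ i)) e) (≡⇒≡ᵇ-true (sym (toℕ-fromℕ< u<s))))
      Tᵢⱼ : T i j ≡ true
      Tᵢⱼ with allRows-true⁻ t _ (allRows-true⁻ s _ filling i) j
      ... | r rewrite Fᵢⱼ = r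

  -- Holds by convexity of the rows and columns of T.
  rectIn-corners : ∀ r₁ r₂ c₁ c₂ → toℕ r₁ ≤ toℕ r₂ → toℕ c₁ ≤ toℕ c₂ →
                   rectIn T r₁ r₂ c₁ c₂ ≡ (T r₁ c₁ ∧ T r₁ c₂ ∧ T r₂ c₁ ∧ T r₂ c₂)
  rectIn-corners r₁ r₂ c₁ c₂ r₁≤r₂ c₁≤c₂ = bool-ext corners fill
    where
      between-true : ∀ {n} (a x b : Fin n) → toℕ a ≤ toℕ x → toℕ x ≤ toℕ b → between a x b ≡ true
      between-true a x b p q = ∧-true (≤⇒≤ᵇ-true p) (≤⇒≤ᵇ-true q)
      inside : rectIn T r₁ r₂ c₁ c₂ ≡ true → ∀ r c → toℕ r₁ ≤ toℕ r → toℕ r ≤ toℕ r₂ → toℕ c₁ ≤ toℕ c → toℕ c ≤ toℕ c₂ → T r c ≡ true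
      inside e r c p q p′ q′ with allRows-true⁻ t _ (allRows-true⁻ s _ e r) c
      ... | h rewrite between-true r₁ r r₂ p q | between-true c₁ c c₂ p′ q′ = h
      corners : rectIn T r₁ r₂ c₁ c₂ ≡ true → (T r₁ c₁ ∧ T r₁ c₂ ∧ T r₂ c₁ ∧ T r₂ c₂) ≡ true
      corners e = ∧-true (inside e r₁ c₁ ≤-refl r₁≤r₂ ≤-refl c₁≤c₂) (∧-true (inside e r₁ c₂ ≤-refl r₁≤r₂ c₁≤c₂ ≤-refl)
                   (∧-true (inside e r₂ c₁ r₁≤r₂ ≤-refl ≤-refl c₁≤c₂) (inside e r₂ c₂ r₁≤r₂ ≤-refl c₁≤c₂ ≤-refl)))
      fill : (T r₁ c₁ ∧ T r₁ c₂ ∧ T r₂ c₁ ∧ T r₂ c₂) ≡ true → rectIn T r₁ r₂ c₁ c₂ ≡ true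
      fill e = allRows-true s _ (λ r → allRows-true t _ (λ c → cell r c))
        where
          rest₁ : (T r₁ c₂ ∧ T r₂ c₁ ∧ T r₂ c₂) ≡ true
          rest₁ = ∧-trueʳ {T r₁ c₁} e
          rest₂ : (T r₂ c₁ ∧ T r₂ c₂) ≡ true
          rest₂ = ∧-trueʳ {T r₁ c₂} rest₁
          cell : ∀ r c → (not (between r₁ r r₂ ∧ between c₁ c c₂) ∨ T r c) ≡ true
          cell r c with between r₁ r r₂ in br | between c₁ c c₂ in bc
          ... | false | _     = refl
          ... | true  | false = refl
          ... | true  | true  =
            colConvex c (rowConvex r₁ (∧-trueˡ e) (∧-trueˡ rest₁) (≤ᵇ-true⇒≤ (∧-trueˡ bc)) (≤ᵇ-true⇒≤ (∧-trueʳ bc)))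
                        (rowConvex r₂ (∧-trueˡ rest₂) (∧-trueʳ {T r₂ c₁} rest₂) (≤ᵇ-true⇒≤ (∧-trueˡ bc)) (≤ᵇ-true⇒≤ (∧-trueʳ bc)))
                        (≤ᵇ-true⇒≤ (∧-trueˡ br)) (≤ᵇ-true⇒≤ (∧-trueʳ br))

  letterAt : Word t → Fin s → Fin t → ℕ
  letterAt w i j = χ (hasLetter (toℕ i) (lookup w j))

  crossingAt : Relᵇ → Word t → Fin t → Fin t → ℕ
  crossingAt c w j j′ = χ ((toℕ j <ᵇ toℕ j′) ∧ crossing c (lookup columns j) (lookup w j) (lookup columns j′) (lookup w j′))

  χ-isAscent-fromWord : ∀ w → AllFit columns w → ∀ i j i′ j′ →
    χ (isAscent T (fromWord w) ((i , j) , (i′ , j′))) ≡ letterAt w i j * (letterAt w i′ j′ * crossingAt _<ᵇ_ w j j′)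
  χ-isAscent-fromWord w o i j i′ j′ rewrite entry-fromWord w i j | entry-fromWord w i′ j′
    with hasLetter (toℕ i) (lookup w j) in e | hasLetter (toℕ i′) (lookup w j′) in e′
  ... | false | _     = refl
  ... | true  | false = sym (*-zeroʳ 1)
  ... | true  | true  rewrite *-identityˡ (1 * crossingAt _<ᵇ_ w j j′) | *-identityˡ (crossingAt _<ᵇ_ w j j′)
    with hasLetter-true⁻ (lookup w j) e | hasLetter-true⁻ (lookup w j′) e′
  ...   | wⱼ | wⱼ′ rewrite wⱼ | wⱼ′
    with toℕ i′ <ᵇ toℕ i in i′<i | toℕ j <ᵇ toℕ j′ in j<j′
  ...     | false | false = refl
  ...     | false | true  = refl
  ...     | true  | false = refl
  ...     | true  | true  rewrite rectIn-corners i′ i j j′ (<⇒≤ (<ᵇ-true⇒< i′<i)) (<⇒≤ (<ᵇ-true⇒< j<j′))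
                                | fits⇒T w i j o wⱼ | fits⇒T w i′ j′ o wⱼ′ | T≡∈columns i′ j | T≡∈columns i j′
                                | ∧-comm (toℕ i′ ∈ᵢ lookup columns j) (toℕ i ∈ᵢ lookup columns j′) = refl

  χ-isDescent-fromWord : ∀ w → AllFit columns w → ∀ i j i′ j′ →
    χ (isDescent T (fromWord w) ((i , j) , (i′ , j′))) ≡ letterAt w i j * (letterAt w i′ j′ * crossingAt (flip _<ᵇ_) w j j′)
  χ-isDescent-fromWord w o i j i′ j′ rewrite entry-fromWord w i j | entry-fromWord w i′ j′
    with hasLetter (toℕ i) (lookup w j) in e | hasLetter (toℕ i′) (lookup w j′) in e′
  ... | false | _     = refl
  ... | true  | false = sym (*-zeroʳ 1)
  ... | true  | true  rewrite *-identityˡ (1 * crossingAt (flip _<ᵇ_) w j j′) | *-identityˡ (crossingAt (flip _<ᵇ_) w j j′)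
    with hasLetter-true⁻ (lookup w j) e | hasLetter-true⁻ (lookup w j′) e′
  ...   | wⱼ | wⱼ′ rewrite wⱼ | wⱼ′
    with toℕ i <ᵇ toℕ i′ in i<i′ | toℕ j <ᵇ toℕ j′ in j<j′
  ...     | false | false = refl
  ...     | false | true  = refl
  ...     | true  | false = refl
  ...     | true  | true  rewrite rectIn-corners i i′ j j′ (<⇒≤ (<ᵇ-true⇒< i<i′)) (<⇒≤ (<ᵇ-true⇒< j<j′))
                                | fits⇒T w i j o wⱼ | fits⇒T w i′ j′ o wⱼ′ | T≡∈columns i j′ | T≡∈columns i′ j
                                | ∧-identityʳ (toℕ i′ ∈ᵢ lookup columns j) = refl

∑-crossingsFrom : ∀ {n} c I x (Is : Vec Interval n) xs →
  (∑ λ k → χ (crossing c I x (lookup Is k) (lookup xs k))) ≡ crossingsFrom c I x Is xs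
∑-crossingsFrom c I x []       []       = refl
∑-crossingsFrom c I x (J ∷ Is) (y ∷ xs) = cong (χ (crossing c I x J y) +_) (∑-crossingsFrom c I x Is xs)

∑-crossings : ∀ {n} c (Is : Vec Interval n) w →
  (∑ λ j → ∑ λ j′ → χ ((toℕ j <ᵇ toℕ j′) ∧ crossing c (lookup Is j) (lookup w j) (lookup Is j′) (lookup w j′)))
  ≡ crossings c Is w
∑-crossings c []       []       = refl
∑-crossings c (I ∷ Is) (x ∷ xs) = cong₂ _+_ (∑-crossingsFrom c I x Is xs) (∑-crossings c Is xs)

module MoonStatistics {s t : ℕ} (T : Shape s t) (M : IsMoonPolyomino T) where
  open ColumnIntervals T M
  open Encoding {s} {t}
  open MoonWords T M

  crossingAt-nothingˡ : ∀ c w j j′ → lookup w j ≡ nothing → crossingAt c w j j′ ≡ 0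
  crossingAt-nothingˡ c w j j′ e rewrite e = cong χ (∧-zeroʳ (toℕ j <ᵇ toℕ j′))

  crossingAt-nothingʳ : ∀ c w j j′ → lookup w j′ ≡ nothing → crossingAt c w j j′ ≡ 0
  crossingAt-nothingʳ c w j j′ e with lookup w j
  ... | nothing = cong χ (∧-zeroʳ (toℕ j <ᵇ toℕ j′))
  ... | just _ rewrite e = cong χ (∧-zeroʳ (toℕ j <ᵇ toℕ j′))

  -- A column of a word carries at most one letter, which picks out one summand.
  ∑-letterAt-* : ∀ w → AllFit columns w → ∀ j X → (lookup w j ≡ nothing → X ≡ 0) → (∑ λ i → letterAt w i j * X) ≡ X
  ∑-letterAt-* w o j X zero-if-empty = begin
    (∑ λ i → letterAt w i j * X) ≡⟨ *-distribʳ-sum X (λ i → letterAt w i j) ⟨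
    (∑ λ i → letterAt w i j) * X ≡⟨ cong (_* X) (∑-hasLetter s (lookup w j) (fits⇒below w o j)) ⟩
    χ (is-just (lookup w j)) * X ≡⟨ one-or-empty (lookup w j) refl ⟩
    X                            ∎
    where
      open ≡-Reasoning
      one-or-empty : ∀ m → lookup w j ≡ m → χ (is-just m) * X ≡ X
      one-or-empty (just _) _ = +-identityʳ X
      one-or-empty nothing  e = sym (zero-if-empty e)

  countᵇ-cellPairs-fromWord : ∀ c w (P : Cell s t × Cell s t → Bool) → AllFit columns w →
    (∀ i j i′ j′ → χ (P ((i , j) , (i′ , j′))) ≡ letterAt w i j * (letterAt w i′ j′ * crossingAt c w j j′)) →
    countᵇ P (cellPairs s t) ≡ crossings c columns w
  countᵇ-cellPairs-fromWord c w P o χP = begin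
    countᵇ P (cellPairs s t)
      ≡⟨ countᵇ-cellPairs s t P ⟩
    (∑ λ i → ∑ λ j → ∑ λ i′ → ∑ λ j′ → χ (P ((i , j) , (i′ , j′))))
      ≡⟨ sum-cong-≗ (λ i → sum-cong-≗ (λ j → sum-cong-≗ (λ i′ → sum-cong-≗ (λ j′ → χP i j i′ j′)))) ⟩
    (∑ λ i → ∑ λ j → ∑ λ i′ → ∑ λ j′ → letterAt w i j * (letterAt w i′ j′ * crossingAt c w j j′))
      ≡⟨ sum-cong-≗ (λ i → sum-cong-≗ (λ j → inner i j)) ⟩
    (∑ λ i → ∑ λ j → letterAt w i j * row j)
      ≡⟨ ∑-comm (λ i j → letterAt w i j * row j) ⟩
    (∑ λ j → ∑ λ i → letterAt w i j * row j)
      ≡⟨ sum-cong-≗ (λ j → ∑-letterAt-* w o j (row j) (λ e → rowEmpty j e)) ⟩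
    (∑ λ j → row j)
      ≡⟨ ∑-crossings c columns w ⟩
    crossings c columns w ∎
    where
      open ≡-Reasoning
      row : Fin t → ℕ
      row j = ∑ λ j′ → crossingAt c w j j′
      rowEmpty : ∀ j → lookup w j ≡ nothing → row j ≡ 0
      rowEmpty j e = trans (sum-cong-≗ (λ j′ → crossingAt-nothingˡ c w j j′ e)) (sum-replicate-zero t)
      inner : ∀ i j → (∑ λ i′ → ∑ λ j′ → letterAt w i j * (letterAt w i′ j′ * crossingAt c w j j′)) ≡ letterAt w i j * row j
      inner i j = begin
        (∑ λ i′ → ∑ λ j′ → letterAt w i j * (letterAt w i′ j′ * crossingAt c w j j′))
          ≡⟨ sum-cong-≗ (λ i′ → *-distribˡ-sum (letterAt w i j) (λ j′ → letterAt w i′ j′ * crossingAt c w j j′)) ⟨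
        (∑ λ i′ → letterAt w i j * ∑ λ j′ → letterAt w i′ j′ * crossingAt c w j j′)
          ≡⟨ *-distribˡ-sum (letterAt w i j) (λ i′ → ∑ λ j′ → letterAt w i′ j′ * crossingAt c w j j′) ⟨
        letterAt w i j * (∑ λ i′ → ∑ λ j′ → letterAt w i′ j′ * crossingAt c w j j′)
          ≡⟨ cong (letterAt w i j *_) (∑-comm (λ i′ j′ → letterAt w i′ j′ * crossingAt c w j j′)) ⟩
        letterAt w i j * (∑ λ j′ → ∑ λ i′ → letterAt w i′ j′ * crossingAt c w j j′)
          ≡⟨ cong (letterAt w i j *_) (sum-cong-≗ (λ j′ → ∑-letterAt-* w o j′ (crossingAt c w j j′) (crossingAt-nothingʳ c w j j′))) ⟩
        letterAt w i j * row j ∎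

  ne₂-fromWord : ∀ w → AllFit columns w → ne₂ T (fromWord w) ≡ crossings _<ᵇ_ columns w
  ne₂-fromWord w o = countᵇ-cellPairs-fromWord _<ᵇ_ w (isAscent T (fromWord w)) o (χ-isAscent-fromWord w o)

  se₂-fromWord : ∀ w → AllFit columns w → se₂ T (fromWord w) ≡ crossings (flip _<ᵇ_) columns w
  se₂-fromWord w o = countᵇ-cellPairs-fromWord (flip _<ᵇ_) w (isDescent T (fromWord w)) o (χ-isDescent-fromWord w o)

-- Symmetric distributions

symDist-involution : ∀ {s t} (T : Shape s t) (S : Array s t → Bool) (Ψ : Array s t → Array s t) →
  (∀ F → Ψ (Ψ F) ≡ F) → (∀ F → S (Ψ F) ≡ S F) → (∀ F → S F ≡ true → ne₂ T (Ψ F) ≡ se₂ T F) → SymDist T S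
symDist-involution {s} {t} T S Ψ involutive S-Ψ ne₂-Ψ a b =
  trans (countᵇ-bijection all all (allArrays-complete s t) (allArrays-unique s t) (allArrays-complete s t) (allArrays-unique s t)
                          Ψ Ψ involutive involutive _)
        (countᵇ-cong all swapped)
  where
    all : List (Array s t)
    all = allArrays s t
    swapped : ∀ F → (S (Ψ F) ∧ (ne₂ T (Ψ F) ≡ᵇ a) ∧ (se₂ T (Ψ F) ≡ᵇ b)) ≡ (S F ∧ (ne₂ T F ≡ᵇ b) ∧ (se₂ T F ≡ᵇ a))
    swapped F rewrite S-Ψ F with S F in e
    ... | false = refl
    ... | true rewrite ne₂-Ψ F e | trans (sym (ne₂-Ψ (Ψ F) (trans (S-Ψ F) e))) (cong (ne₂ T) (involutive F))
      = ∧-comm (se₂ T F ≡ᵇ a) (ne₂ T F ≡ᵇ b)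

record SameMargins {s t : ℕ} (T : Shape s t) (G F : Array s t) : Set where
  field
    sameFilling  : isFilling T G ≡ isFilling T F
    sameRowCount : ∀ i → rowCount G i ≡ rowCount F i
    sameColCount : ∀ j → colCount G j ≡ colCount F j
open SameMargins

module _ {s t : ℕ} (T : Shape s t) {G F : Array s t} (same : SameMargins T G F) where

  private
    atMostOne-rows : allRows s (λ i → rowCount G i ≤ᵇ 1) ≡ allRows s (λ i → rowCount F i ≤ᵇ 1)
    atMostOne-rows = allRows-cong s (λ i → cong (_≤ᵇ 1) (sameRowCount same i))
    atMostOne-cols : allRows t (λ j → colCount G j ≤ᵇ 1) ≡ allRows t (λ j → colCount F j ≤ᵇ 1)
    atMostOne-cols = allRows-cong t (λ j → cong (_≤ᵇ 1) (sameColCount same j))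
    emptyCols : ∀ (A : Subset t) → allRows t (λ j → (colCount G j ≡ᵇ 0) ⇔ᵇ lookup A j) ≡ allRows t (λ j → (colCount F j ≡ᵇ 0) ⇔ᵇ lookup A j)
    emptyCols A = allRows-cong t (λ j → cong (λ z → (z ≡ᵇ 0) ⇔ᵇ lookup A j) (sameColCount same j))
    emptyRows : ∀ (B : Subset s) → allRows s (λ i → (rowCount G i ≡ᵇ 0) ⇔ᵇ lookup B i) ≡ allRows s (λ i → (rowCount F i ≡ᵇ 0) ⇔ᵇ lookup B i)
    emptyRows B = allRows-cong s (λ i → cong (λ z → (z ≡ᵇ 0) ⇔ᵇ lookup B i) (sameRowCount same i))

  inNc-margins : ∀ m → inNc T m G ≡ inNc T m F
  inNc-margins m = cong₂ _∧_ (sameFilling same) (cong₂ _∧_ atMostOne-cols (allRows-cong s (λ i → cong (_≡ᵇ lookup m i) (sameRowCount same i))))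

  inNcA-margins : ∀ m A → inNcA T m A G ≡ inNcA T m A F
  inNcA-margins m A = cong₂ _∧_ (inNc-margins m) (emptyCols A)

  inNAB-margins : ∀ A B → inNAB T A B G ≡ inNAB T A B F
  inNAB-margins A B = cong₂ _∧_ (sameFilling same) (cong₂ _∧_ atMostOne-rows (cong₂ _∧_ atMostOne-cols (cong₂ _∧_ (emptyCols A) (emptyRows B))))

colFilling : ∀ {s t} → Shape s t → Array s t → Bool
colFilling {s} {t} T F = isFilling T F ∧ allRows t (λ j → colCount F j ≤ᵇ 1)

inNc⇒colFilling : ∀ {s t} (T : Shape s t) m F → inNc T m F ≡ true → colFilling T F ≡ true
inNc⇒colFilling {s} {t} T m F e =
  ∧-true (∧-trueˡ e) (∧-trueˡ {allRows t (λ j → colCount F j ≤ᵇ 1)} (∧-trueʳ {isFilling T F} e))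

inNAB⇒colFilling : ∀ {s t} (T : Shape s t) A B F → inNAB T A B F ≡ true → colFilling T F ≡ true
inNAB⇒colFilling {s} {t} T A B F e =
  ∧-true (∧-trueˡ e) (∧-trueˡ {allRows t (λ j → colCount F j ≤ᵇ 1)} (∧-trueʳ {allRows s (λ i → rowCount F i ≤ᵇ 1)} (∧-trueʳ {isFilling T F} e)))

module ColumnInvolution {s t : ℕ} (T : Shape s t) (M : IsMoonPolyomino T) where
  open ColumnIntervals T M
  open Encoding {s} {t}
  open MoonWords T M
  open MoonStatistics T M

  Ψ : Array s t → Array s t
  Ψ F = if colFilling T F then fromWord (Φ s columns (toWord F)) else F

  module OnColFilling (F : Array s t) (filling : colFilling T F ≡ true) where
    open ≡-Reasoning

    atMostOne : ∀ j → colCount F j ≤ 1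
    atMostOne j = ≤ᵇ-true⇒≤ (allRows-true⁻ t _ (∧-trueʳ {isFilling T F} filling) j)

    w : Word t
    w = toWord F

    fits-w : AllFit columns w
    fits-w = toWord-fits F atMostOne (∧-trueˡ filling)

    spec : ΦSpec s columns w
    spec = Φ-spec s columns w columns-chain columns-bounded fits-w

    w′ : Word t
    w′ = Φ s columns w

    fits-w′ : AllFit columns w′
    fits-w′ = fits spec

    Ψ≡ : Ψ F ≡ fromWord w′
    Ψ≡ rewrite filling = refl

    F≡ : fromWord w ≡ F
    F≡ = fromWord-toWord F atMostOne

    margins : SameMargins T (Ψ F) F
    margins = record
      { sameFilling = begin
          isFilling T (Ψ F)          ≡⟨ cong (isFilling T) Ψ≡ ⟩
          isFilling T (fromWord w′)  ≡⟨ isFilling-fromWord w′ fits-w′ ⟩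
          true                       ≡⟨ ∧-trueˡ filling ⟨
          isFilling T F              ∎
      ; sameRowCount = λ i → begin
          rowCount (Ψ F) i            ≡⟨ cong (λ G → rowCount G i) Ψ≡ ⟩
          rowCount (fromWord w′) i    ≡⟨ rowCount-fromWord w′ i ⟩
          occurrences (toℕ i) w′      ≡⟨ occurrences-Φ spec (toℕ i) ⟩
          occurrences (toℕ i) w       ≡⟨ rowCount-fromWord w i ⟨
          rowCount (fromWord w) i     ≡⟨ cong (λ G → rowCount G i) F≡ ⟩
          rowCount F i                ∎
      ; sameColCount = λ j → begin
          colCount (Ψ F) j              ≡⟨ cong (λ G → colCount G j) Ψ≡ ⟩
          colCount (fromWord w′) j      ≡⟨ colCount-fromWord w′ j (fits⇒below w′ fits-w′ j) ⟩
          χ (is-just (lookup w′ j))     ≡⟨ cong χ (lookup-support w′ j) ⟨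
          χ (lookup (support w′) j)     ≡⟨ cong (λ v → χ (lookup v j)) (support-Φ spec) ⟩
          χ (lookup (support w) j)      ≡⟨ cong χ (lookup-support w j) ⟩
          χ (is-just (lookup w j))      ≡⟨ colCount-fromWord w j (fits⇒below w fits-w j) ⟨
          colCount (fromWord w) j       ≡⟨ cong (λ G → colCount G j) F≡ ⟩
          colCount F j                  ∎
      }
      where
        lookup-support : ∀ {n} (v : Word n) j → lookup (support v) j ≡ is-just (lookup v j)
        lookup-support v j = lookup-map j is-just v

    colFilling-Ψ : colFilling T (Ψ F) ≡ true
    colFilling-Ψ = trans (cong₂ _∧_ (sameFilling margins) (allRows-cong t (λ j → cong (_≤ᵇ 1) (sameColCount margins j)))) filling

    Ψ-Ψ : Ψ (Ψ F) ≡ F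
    Ψ-Ψ = begin
      Ψ (Ψ F)                         ≡⟨ Ψ≡′ ⟩
      fromWord (Φ s columns (toWord (Ψ F))) ≡⟨ cong (λ v → fromWord (Φ s columns v)) (trans (cong toWord Ψ≡) (toWord-fromWord w′ (fits⇒below w′ fits-w′))) ⟩
      fromWord (Φ s columns w′)       ≡⟨ cong fromWord (involutive spec) ⟩
      fromWord w                      ≡⟨ F≡ ⟩
      F                               ∎
      where
        Ψ≡′ : Ψ (Ψ F) ≡ fromWord (Φ s columns (toWord (Ψ F)))
        Ψ≡′ rewrite colFilling-Ψ = refl

    ne₂-Ψ : ne₂ T (Ψ F) ≡ se₂ T F
    ne₂-Ψ = begin
      ne₂ T (Ψ F)                        ≡⟨ cong (ne₂ T) Ψ≡ ⟩
      ne₂ T (fromWord w′)                ≡⟨ ne₂-fromWord w′ fits-w′ ⟩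
      crossings _<ᵇ_ columns w′          ≡⟨ crossings-Φ spec ⟩
      crossings (flip _<ᵇ_) columns w    ≡⟨ se₂-fromWord w fits-w ⟨
      se₂ T (fromWord w)                 ≡⟨ cong (se₂ T) F≡ ⟩
      se₂ T F                            ∎

  Ψ-¬colFilling : ∀ F → colFilling T F ≡ false → Ψ F ≡ F
  Ψ-¬colFilling F e rewrite e = refl

  Ψ-margins : ∀ F → SameMargins T (Ψ F) F
  Ψ-margins F with true-or-false (colFilling T F)
  ... | inj₁ e = OnColFilling.margins F e
  ... | inj₂ e = record { sameFilling = cong (isFilling T) (Ψ-¬colFilling F e)
                        ; sameRowCount = λ i → cong (λ G → rowCount G i) (Ψ-¬colFilling F e)
                        ; sameColCount = λ j → cong (λ G → colCount G j) (Ψ-¬colFilling F e) }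

  Ψ-involutive : ∀ F → Ψ (Ψ F) ≡ F
  Ψ-involutive F with true-or-false (colFilling T F)
  ... | inj₁ e = OnColFilling.Ψ-Ψ F e
  ... | inj₂ e = trans (cong Ψ (Ψ-¬colFilling F e)) (Ψ-¬colFilling F e)

  symDist-colFilling : (S : Array s t → Bool) → (∀ F → S (Ψ F) ≡ S F) → (∀ F → S F ≡ true → colFilling T F ≡ true) → SymDist T S
  symDist-colFilling S S-Ψ S⇒colFilling = symDist-involution T S Ψ Ψ-involutive S-Ψ (λ F e → OnColFilling.ne₂-Ψ F (S⇒colFilling F e))

_ᵀ : ∀ {s t} → Shape s t → Shape t s
(T ᵀ) j i = T i j

isMoonᵀ : ∀ {s t} {T : Shape s t} → IsMoonPolyomino T → IsMoonPolyomino (T ᵀ)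
isMoonᵀ M = record
  { rowNonempty = colNonempty ; colNonempty = rowNonempty
  ; rowConvex = colConvex ; colConvex = rowConvex
  ; rowsNested = colsNested ; colsNested = rowsNested }
  where open IsMoonPolyomino M

transpose : ∀ {s t} → Array s t → Array t s
transpose F = V.tabulate (λ j → V.tabulate (λ i → entry F i j))

entry-transpose : ∀ {s t} (F : Array s t) j i → entry (transpose F) j i ≡ entry F i j
entry-transpose F j i rewrite lookup∘tabulate (λ j → V.tabulate (λ i → entry F i j)) j = lookup∘tabulate (λ i → entry F i j) i

transpose-involutive : ∀ {s t} (F : Array s t) → transpose (transpose F) ≡ F
transpose-involutive F = array-ext (transpose (transpose F)) F (λ i j → trans (entry-transpose (transpose F) i j) (entry-transpose F j i))

allRows-comm : ∀ m n (p : Fin m → Fin n → Bool) → allRows m (λ i → allRows n (p i)) ≡ allRows n (λ j → allRows m (λ i → p i j))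
allRows-comm m n p = bool-ext
  (λ e → allRows-true n _ (λ j → allRows-true m _ (λ i → allRows-true⁻ n _ (allRows-true⁻ m _ e i) j)))
  (λ e → allRows-true m _ (λ i → allRows-true n _ (λ j → allRows-true⁻ m _ (allRows-true⁻ n _ e j) i)))

∑₄-transpose : ∀ {m n} (h : Fin m → Fin n → Fin m → Fin n → ℕ) →
  (∑ λ a → ∑ λ b → ∑ λ c → ∑ λ d → h a b c d) ≡ (∑ λ b → ∑ λ a → ∑ λ d → ∑ λ c → h a b c d)
∑₄-transpose h = trans (sum-cong-≗ (λ a → sum-cong-≗ (λ b → ∑-comm (h a b)))) (∑-comm (λ a b → ∑ λ d → ∑ λ c → h a b c d))

∑₄-swap : ∀ {m n} (h : Fin m → Fin n → Fin m → Fin n → ℕ) →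
  (∑ λ a → ∑ λ b → ∑ λ c → ∑ λ d → h a b c d) ≡ (∑ λ c → ∑ λ d → ∑ λ a → ∑ λ b → h a b c d)
∑₄-swap h = begin
    (∑ λ a → ∑ λ b → ∑ λ c → ∑ λ d → h a b c d) ≡⟨ sum-cong-≗ (λ a → ∑-comm (λ b c → ∑ λ d → h a b c d)) ⟩
    (∑ λ a → ∑ λ c → ∑ λ b → ∑ λ d → h a b c d) ≡⟨ ∑-comm (λ a c → ∑ λ b → ∑ λ d → h a b c d) ⟩
    (∑ λ c → ∑ λ a → ∑ λ b → ∑ λ d → h a b c d) ≡⟨ sum-cong-≗ (λ c → sum-cong-≗ (λ a → ∑-comm (λ b d → h a b c d))) ⟩
    (∑ λ c → ∑ λ a → ∑ λ d → ∑ λ b → h a b c d) ≡⟨ sum-cong-≗ (λ c → ∑-comm (λ a d → ∑ λ b → h a b c d)) ⟩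
    (∑ λ c → ∑ λ d → ∑ λ a → ∑ λ b → h a b c d) ∎
  where open ≡-Reasoning

∧-swapˡ : ∀ a b c → (a ∧ b ∧ c) ≡ (b ∧ a ∧ c)
∧-swapˡ false false c = refl
∧-swapˡ false true  c = refl
∧-swapˡ true  false c = refl
∧-swapˡ true  true  c = refl

module _ {s t : ℕ} (T : Shape s t) where

  isFilling-transpose : ∀ F → isFilling (T ᵀ) (transpose F) ≡ isFilling T F
  isFilling-transpose F = trans (allRows-cong t (λ j → allRows-cong s (λ i → cong (λ b → not b ∨ T i j) (entry-transpose F j i))))
                                (sym (allRows-comm s t (λ i j → not (entry F i j) ∨ T i j)))

  rowCount-transpose : ∀ (F : Array s t) j → rowCount (transpose F) j ≡ colCount F j
  rowCount-transpose F j = countᵇ-cong (allFin s) (entry-transpose F j)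

  colCount-transpose : ∀ (F : Array s t) i → colCount (transpose F) i ≡ rowCount F i
  colCount-transpose F i = countᵇ-cong (allFin t) (λ j → entry-transpose F j i)

  inNr≡inNcᵀ : ∀ n F → inNr T n F ≡ inNc (T ᵀ) n (transpose F)
  inNr≡inNcᵀ n F = sym (cong₂ _∧_ (isFilling-transpose F)
                         (cong₂ _∧_ (allRows-cong s (λ i → cong (_≤ᵇ 1) (colCount-transpose F i)))
                                    (allRows-cong t (λ j → cong (_≡ᵇ lookup n j) (rowCount-transpose F j)))))

  inNrB≡inNcAᵀ : ∀ n B F → inNrB T n B F ≡ inNcA (T ᵀ) n B (transpose F)
  inNrB≡inNcAᵀ n B F = cong₂ _∧_ (inNr≡inNcᵀ n F) (allRows-cong s (λ i → cong (λ z → (z ≡ᵇ 0) ⇔ᵇ lookup B i) (sym (colCount-transpose F i))))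

  rectIn-transpose : ∀ a b c d → rectIn (T ᵀ) a b c d ≡ rectIn T c d a b
  rectIn-transpose a b c d = trans (allRows-comm t s _) (allRows-cong s (λ r → allRows-cong t (λ c′ →
                               cong (λ z → not z ∨ T r c′) (∧-comm (between a c′ b) (between c r d)))))

  isAscent-transpose : ∀ F r c r′ c′ → isAscent (T ᵀ) (transpose F) ((r , c) , (r′ , c′)) ≡ isAscent T F ((c′ , r′) , (c , r))
  isAscent-transpose F r c r′ c′ rewrite entry-transpose F r c | entry-transpose F r′ c′ | rectIn-transpose r′ r c c′ =
    trans (∧-swapˡ (entry F c r) (entry F c′ r′) _) (cong (λ b → entry F c′ r′ ∧ entry F c r ∧ b) (∧-swapˡ (toℕ r′ <ᵇ toℕ r) (toℕ c <ᵇ toℕ c′) _))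

  isDescent-transpose : ∀ F r c r′ c′ → isDescent (T ᵀ) (transpose F) ((r , c) , (r′ , c′)) ≡ isDescent T F ((c , r) , (c′ , r′))
  isDescent-transpose F r c r′ c′ rewrite entry-transpose F r c | entry-transpose F r′ c′ | rectIn-transpose r r′ c c′ =
    cong (λ b → entry F c r ∧ entry F c′ r′ ∧ b) (∧-swapˡ (toℕ r <ᵇ toℕ r′) (toℕ c <ᵇ toℕ c′) _)

  ne₂-transpose : ∀ F → ne₂ (T ᵀ) (transpose F) ≡ ne₂ T F
  ne₂-transpose F = begin
    ne₂ (T ᵀ) (transpose F)
      ≡⟨ countᵇ-cellPairs t s _ ⟩
    (∑ λ r → ∑ λ c → ∑ λ r′ → ∑ λ c′ → χ (isAscent (T ᵀ) (transpose F) ((r , c) , (r′ , c′))))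
      ≡⟨ sum-cong-≗ (λ r → sum-cong-≗ (λ c → sum-cong-≗ (λ r′ → sum-cong-≗ (λ c′ → cong χ (isAscent-transpose F r c r′ c′))))) ⟩
    (∑ λ r → ∑ λ c → ∑ λ r′ → ∑ λ c′ → ascent c′ r′ c r)
      ≡⟨ ∑₄-transpose (λ r c r′ c′ → ascent c′ r′ c r) ⟩
    (∑ λ c → ∑ λ r → ∑ λ c′ → ∑ λ r′ → ascent c′ r′ c r)
      ≡⟨ ∑₄-swap (λ c r c′ r′ → ascent c′ r′ c r) ⟩
    (∑ λ c′ → ∑ λ r′ → ∑ λ c → ∑ λ r → ascent c′ r′ c r)
      ≡⟨ countᵇ-cellPairs s t _ ⟨
    ne₂ T F ∎
    where
      open ≡-Reasoning
      ascent : Fin s → Fin t → Fin s → Fin t → ℕ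
      ascent i j i′ j′ = χ (isAscent T F ((i , j) , (i′ , j′)))

  se₂-transpose : ∀ F → se₂ (T ᵀ) (transpose F) ≡ se₂ T F
  se₂-transpose F = begin
    se₂ (T ᵀ) (transpose F)
      ≡⟨ countᵇ-cellPairs t s _ ⟩
    (∑ λ r → ∑ λ c → ∑ λ r′ → ∑ λ c′ → χ (isDescent (T ᵀ) (transpose F) ((r , c) , (r′ , c′))))
      ≡⟨ sum-cong-≗ (λ r → sum-cong-≗ (λ c → sum-cong-≗ (λ r′ → sum-cong-≗ (λ c′ → cong χ (isDescent-transpose F r c r′ c′))))) ⟩
    (∑ λ r → ∑ λ c → ∑ λ r′ → ∑ λ c′ → descent c r c′ r′)
      ≡⟨ ∑₄-transpose (λ r c r′ c′ → descent c r c′ r′) ⟩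
    (∑ λ c → ∑ λ r → ∑ λ c′ → ∑ λ r′ → descent c r c′ r′)
      ≡⟨ countᵇ-cellPairs s t _ ⟨
    se₂ T F ∎
    where
      open ≡-Reasoning
      descent : Fin s → Fin t → Fin s → Fin t → ℕ
      descent i j i′ j′ = χ (isDescent T F ((i , j) , (i′ , j′)))

  symDist-transpose : (S : Array s t → Bool) (Sᵀ : Array t s → Bool) → (∀ F → S F ≡ Sᵀ (transpose F)) →
                      SymDist (T ᵀ) Sᵀ → SymDist T S
  symDist-transpose S Sᵀ S≡ symᵀ a b = begin
    countᵇ (λ F → S F ∧ (ne₂ T F ≡ᵇ a) ∧ (se₂ T F ≡ᵇ b)) (allArrays s t)  ≡⟨ countᵇ-cong (allArrays s t) (viaTranspose a b) ⟩
    countᵇ (pᵀ a b ∘ transpose) (allArrays s t)                            ≡⟨ countᵇ-transpose (pᵀ a b) ⟨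
    countᵇ (pᵀ a b) (allArrays t s)                                        ≡⟨ symᵀ a b ⟩
    countᵇ (pᵀ b a) (allArrays t s)                                        ≡⟨ countᵇ-transpose (pᵀ b a) ⟩
    countᵇ (pᵀ b a ∘ transpose) (allArrays s t)                            ≡⟨ countᵇ-cong (allArrays s t) (viaTranspose b a) ⟨
    countᵇ (λ F → S F ∧ (ne₂ T F ≡ᵇ b) ∧ (se₂ T F ≡ᵇ a)) (allArrays s t)  ∎
    where
      open ≡-Reasoning
      pᵀ : ℕ → ℕ → Array t s → Bool
      pᵀ a b G = Sᵀ G ∧ (ne₂ (T ᵀ) G ≡ᵇ a) ∧ (se₂ (T ᵀ) G ≡ᵇ b)
      viaTranspose : ∀ a b F → (S F ∧ (ne₂ T F ≡ᵇ a) ∧ (se₂ T F ≡ᵇ b)) ≡ pᵀ a b (transpose F)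
      viaTranspose a b F rewrite S≡ F | ne₂-transpose F | se₂-transpose F = refl
      countᵇ-transpose : ∀ (p : Array t s → Bool) → countᵇ p (allArrays t s) ≡ countᵇ (p ∘ transpose) (allArrays s t)
      countᵇ-transpose = countᵇ-bijection (allArrays s t) (allArrays t s) (allArrays-complete s t) (allArrays-unique s t)
                           (allArrays-complete t s) (allArrays-unique t s) transpose transpose transpose-involutive transpose-involutive

module _ {s t : ℕ} (T : Shape s t) (M : IsMoonPolyomino T) where
  open ColumnInvolution T M

  symDist-inNcA : ∀ m A → SymDist T (inNcA T m A)
  symDist-inNcA m A = symDist-colFilling (inNcA T m A) (λ F → inNcA-margins T (Ψ-margins F) m A) (λ F → inNc⇒colFilling T m F ∘ ∧-trueˡ)

  symDist-inNc : ∀ m → SymDist T (inNc T m)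
  symDist-inNc m = symDist-colFilling (inNc T m) (λ F → inNc-margins T (Ψ-margins F) m) (inNc⇒colFilling T m)

  symDist-inNAB : ∀ A B → SymDist T (inNAB T A B)
  symDist-inNAB A B = symDist-colFilling (inNAB T A B) (λ F → inNAB-margins T (Ψ-margins F) A B) (inNAB⇒colFilling T A B)

symDist-inNrB : ∀ {s t} (T : Shape s t) → IsMoonPolyomino T → ∀ n B → SymDist T (inNrB T n B)
symDist-inNrB T M n B = symDist-transpose T (inNrB T n B) (inNcA (T ᵀ) n B) (inNrB≡inNcAᵀ T n B) (symDist-inNcA (T ᵀ) (isMoonᵀ M) n B)

symDist-inNr : ∀ {s t} (T : Shape s t) → IsMoonPolyomino T → ∀ n → SymDist T (inNr T n)
symDist-inNr T M n = symDist-transpose T (inNr T n) (inNc (T ᵀ) n) (inNr≡inNcᵀ T n) (symDist-inNc (T ᵀ) (isMoonᵀ M) n)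

corollary2p4 : ∀ {s t : ℕ} (T : Shape s t) → IsMoonPolyomino T →
    (∀ (m : Vec ℕ s) (A : Subset t) → SymDist T (inNcA T m A))
    × (∀ (n : Vec ℕ t) (B : Subset s) → SymDist T (inNrB T n B))
    × (∀ (A : Subset t) (B : Subset s) → SymDist T (inNAB T A B))
    × (∀ (m : Vec ℕ s) → SymDist T (inNc T m))
    × (∀ (n : Vec ℕ t) → SymDist T (inNr T n))
corollary2p4 T M = symDist-inNcA T M , symDist-inNrB T M , symDist-inNAB T M , symDist-inNc T M , symDist-inNr T M
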